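{- Let $K \ge 1$ and let $\sigma^1,\ldots,\sigma^K$ be permutations of lengths $n_1,\ldots,n_K$. Let $M$ be the array computed by the dynamic programming procedure described below. Then $M(1,n_1,1,n_1,\ldots,1,n_K,1,n_K)$ is a separable permutation that is a pattern of every $\sigma^q$ and has maximal length among all such separable common patterns. (More generally, each entry $M(i_1,j_1,a_1,b_1,\ldots,i_K,j_K,a_K,b_K)$ is a longest separable permutation having, for every $q$, an occurrence in $\sigma^q$ using the interval $[i_q..j_q]$ of indices and $[a_q..b_q]$ of values.)
   Context: A permutation of length $n$ is a bijection of $[1..n]$, written $\sigma_1\cdots\sigma_n$. A permutation $\pi$ of length $k$ has an occurrence $\sigma_{i_1}\cdots\sigma_{i_k}$ ($i_1<\cdots<i_k$) in $\sigma$ if $\sigma_{i_\ell} < \sigma_{i_m}$ whenever $\pi_\ell < \pi_m$; the occurrence uses the interval $I$ of indices and $V$ of values if $\{i_1,\ldots,i_k\} \subseteq I$ and $\{\sigma_{i_1},\ldots,\sigma_{i_k}\} \subseteq V$. Separable permutations are those avoiding $2413$ and $3142$. For $\pi$ of length $k$, $\pi'$ of length $k'$: $\pi \oplus \pi' = \pi_1\cdots\pi_k(\pi'_1+k)\cdots(\pi'_{k'}+k)$, $\pi \ominus \pi' = (\pi_1+k')\cdots(\pi_k+k')\pi'_1\cdots\pi'_{k'}$; $\epsilon$ denotes the empty permutation and $1$ the permutation of length one. The procedure: $M$ is indexed by all $(i_1,j_1,a_1,b_1,\ldots,i_K,j_K,a_K,b_K)$ with $i_q,j_q,a_q,b_q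 \in [1..n_q]$, initialized to $\epsilon$. Entries with $i_q \le j_q$, $a_q \le b_q$ for all $q$ are filled by increasing values of $\sum_q (j_q-i_q)+(b_q-a_q)$ as follows. Let $T$ be the condition "for every $q$ there is $h_q \in [i_q..j_q]$ with $\sigma^q_{h_q} \in [a_q..b_q]$". If some $q$ has $i_q=j_q$ or $a_q=b_q$, the entry is set to $1$ if $T$ holds and to $\epsilon$ otherwise. Otherwise the entry is set to a longest element of $S_\oplus \cup S_\ominus \cup S$, where $S_\oplus$ is the set of all $M(i_1,h_1-1,a_1,c_1-1,\ldots,i_K,h_K-1,a_K,c_K-1) \oplus M(h_1,j_1,c_1,b_1,\ldots,h_K,j_K,c_K,b_K)$, $S_\ominus$ is the set of all $M(i_1,h_1-1,c_1,b_1,\ldots,i_K,h_K-1,c_K,b_K) \ominus M(h_1,j_1,a_1,c_1-1,\ldots,h_K,j_K,a_K,c_K-1)$, both over all choices $i_q<h_q\le j_q$, $a_q<c_q\le b_q$ ($q \in [1..K]$), and $S=\{1\}$ if $T$ holds, $S=\{\epsilon\}$ otherwise. -}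

module Defs where

open import Data.Nat using (ℕ; zero; suc; _+_; _∸_; _≤_; _<_)
open import Data.List using (List; []; _∷_; length; map; _++_; upTo)
open import Data.List.Relation.Binary.Permutation.Propositional using (_↭_)
open import Data.Fin using (Fin)
open import Data.Product using (Σ; _×_)
open import Data.Sum using (_⊎_)
open import Relation.Nullary using (¬_)
open import Relation.Binary.PropositionalEquality using (_≡_)

-- Permutations are lists of naturals σ₁ ⋯ σₙ (1-based positions).

-- 1-based lookup; returns 0 outside [1..length].
_!_ : List ℕ → ℕ → ℕ
[]       ! _             = 0
(x ∷ xs) ! zero          = 0
(x ∷ xs) ! suc zero      = x
(x ∷ xs) ! suc (suc k)   = xs ! suc k

range : ℕ → List ℕ
range n = map suc (upTo n)

IsPerm : List ℕ → Set
IsPerm p = p ↭ range (length p)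

ε : List ℕ
ε = []

one : List ℕ
one = 1 ∷ []

_⊕_ : List ℕ → List ℕ → List ℕ
p ⊕ p' = p ++ map (_+ length p) p'

_⊖_ : List ℕ → List ℕ → List ℕ
p ⊖ p' = map (_+ length p') p ++ p'

OccursUsing : (π σ : List ℕ) (i j a b : ℕ) → Set
OccursUsing π σ i j a b = Σ (ℕ → ℕ) λ ι →
  (∀ ℓ → 1 ≤ ℓ → ℓ < length π → ι ℓ < ι (suc ℓ)) ×
  (∀ ℓ → 1 ≤ ℓ → ℓ ≤ length π →
     1 ≤ ι ℓ × ι ℓ ≤ length σ × i ≤ ι ℓ × ι ℓ ≤ j ×
     a ≤ σ ! ι ℓ × σ ! ι ℓ ≤ b) ×
  (∀ ℓ m → 1 ≤ ℓ → ℓ ≤ length π → 1 ≤ m → m ≤ length π →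
     π ! ℓ < π ! m → σ ! ι ℓ < σ ! ι m)

IsPatternOf : (π σ : List ℕ) → Set
IsPatternOf π σ = OccursUsing π σ 1 (length σ) 1 (length σ)

Avoids : (π τ : List ℕ) → Set
Avoids π τ = ¬ IsPatternOf τ π

Separable : List ℕ → Set
Separable π =
  IsPerm π × Avoids π (2 ∷ 4 ∷ 1 ∷ 3 ∷ []) × Avoids π (3 ∷ 1 ∷ 4 ∷ 2 ∷ [])

-- The dynamic programming array.  An entry is indexed by four
-- K-tuples i j a b (entry (i₁,j₁,a₁,b₁,…,i_K,j_K,a_K,b_K)).

Array : ℕ → Set
Array K = (i j a b : Fin K → ℕ) → List ℕ

module _ {K : ℕ} (σ : Fin K → List ℕ) where

  len : Fin K → ℕ
  len q = length (σ q)

  Filled : (i j a b : Fin K → ℕ) → Set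
  Filled i j a b = ∀ q →
    1 ≤ i q × i q ≤ j q × j q ≤ len q ×
    1 ≤ a q × a q ≤ b q × b q ≤ len q

  CondT : (i j a b : Fin K → ℕ) → Set
  CondT i j a b = ∀ q → Σ ℕ λ h →
    i q ≤ h × h ≤ j q × a q ≤ σ q ! h × σ q ! h ≤ b q

  Degenerate : (i j a b : Fin K → ℕ) → Set
  Degenerate i j a b = Σ (Fin K) λ q → i q ≡ j q ⊎ a q ≡ b q

  Split : (i j a b h c : Fin K → ℕ) → Set
  Split i j a b h c = ∀ q → i q < h q × h q ≤ j q × a q < c q × c q ≤ b q

  Candidate : Array K → (i j a b : Fin K → ℕ) → List ℕ → Set
  Candidate M i j a b τ =
    (Σ (Fin K → ℕ) λ h → Σ (Fin K → ℕ) λ c → Split i j a b h c ×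
       τ ≡ (M i (λ q → h q ∸ 1) a (λ q → c q ∸ 1) ⊕ M h j c b))
    ⊎ (Σ (Fin K → ℕ) λ h → Σ (Fin K → ℕ) λ c → Split i j a b h c ×
       τ ≡ (M i (λ q → h q ∸ 1) c b ⊖ M h j a (λ q → c q ∸ 1)))
    ⊎ (CondT i j a b × τ ≡ one)
    ⊎ (¬ CondT i j a b × τ ≡ ε)

  -- M is an array produced by the procedure (with arbitrary choice
  -- among the longest candidates).
  IsDPArray : Array K → Set
  IsDPArray M =
    (∀ i j a b → ¬ Filled i j a b → M i j a b ≡ ε) ×
    (∀ i j a b → Filled i j a b → Degenerate i j a b →
       (CondT i j a b → M i j a b ≡ one) ×
       (¬ CondT i j a b → M i j a b ≡ ε)) ×
    (∀ i j a b → Filled i j a b → ¬ Degenerate i j a b →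
       Candidate M i j a b (M i j a b) ×
       (∀ τ → Candidate M i j a b τ → length τ ≤ length (M i j a b)))

  LongestSepCommonPattern : List ℕ → Set
  LongestSepCommonPattern π =
    Separable π × (∀ q → IsPatternOf π (σ q)) ×
    (∀ τ → Separable τ → (∀ q → IsPatternOf τ (σ q)) → length τ ≤ length π)

  LongestSepInBoxes : (i j a b : Fin K → ℕ) → List ℕ → Set
  LongestSepInBoxes i j a b π =
    Separable π × (∀ q → OccursUsing π (σ q) (i q) (j q) (a q) (b q)) ×
    (∀ τ → Separable τ →
       (∀ q → OccursUsing τ (σ q) (i q) (j q) (a q) (b q)) →
       length τ ≤ length π)

{-# OPTIONS --safe #-}

-- Separable permutations are built from 1 by direct sums ⊕ and skew sums ⊖, and
-- occurrences of such sums decompose along the boxes of the recurrence.  A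
-- separable sequence of length at least two splits into a prefix lying entirely
-- below (⊕) or entirely above (⊖) its suffix: by induction on the length,
-- appending an entry to a split sequence yields a new split unless it creates a
-- 3142 (a 2413 in the skew case).  An occurrence of A ⊕ B in σ is cut at the
-- position h of the first entry of B and at the value c just above the values
-- used by A into occurrences of A and B in the two sub-boxes the recurrence
-- inspects; conversely occurrences there glue to one of A ⊕ B, which is
-- separable because no 3142 or 2413 can straddle the cut.  Soundness and
-- maximality of every entry follow by well-founded induction on the number of
-- positions of the box in σ¹.
module Submission where

open import Defs
open import Data.Nat using (ℕ; zero; suc; _+_; _∸_; _⊔_; _≤_; _<_; _≤?_; _<?_; _≟_; z≤n; s≤s; s≤s⁻¹)
open import Data.Nat.Properties
open import Data.Nat.Induction using (<-wellFounded)
open import Induction.WellFounded using (Acc; acc)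
open import Data.List using (List; []; _∷_; length; map; _++_; upTo; applyUpTo)
open import Data.List.Properties using (length-++; length-map; map-cong; map-∘; map-upTo)
open import Data.List.Membership.Propositional using (_∈_)
open import Data.List.Membership.Propositional.Properties using (∈-map⁻; ∈-upTo⁻)
import Data.List.Relation.Unary.All as All
open import Data.List.Relation.Unary.Any using (here; there)
open import Data.List.Relation.Unary.AllPairs using (_∷_)
open import Data.List.Relation.Unary.Unique.Propositional using (Unique)
import Data.List.Relation.Unary.Unique.Propositional.Properties as Unique
open import Data.List.Relation.Binary.Permutation.Propositional using (↭-refl; ↭-sym; ↭-trans; ↭⇒↭ₛ)
open import Data.List.Relation.Binary.Permutation.Propositional.Properties using (∈-resp-↭; ++⁺; ++-comm)
import Data.List.Relation.Binary.Permutation.Propositional.Properties as Perm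
open import Data.Fin as Fin using (Fin; toℕ; fromℕ<)
open import Data.Fin.Properties using (any?; all?; toℕ≤pred[n]; toℕ-fromℕ<)
open import Data.Product using (Σ; ∃; ∃-syntax; _×_; _,_; proj₁; proj₂; map₂)
open import Data.Sum using (_⊎_; inj₁; inj₂; swap)
open import Data.Empty using (⊥; ⊥-elim)
open import Function using (flip; _∘_)
open import Level using (0ℓ)
open import Relation.Nullary using (¬_; Dec; yes; no)
open import Relation.Nullary.Decidable using (True; toWitness; map′; _×-dec_; _⊎-dec_)
open import Relation.Unary using (Decidable)
open import Relation.Binary using (Rel; Asymmetric; IsStrictTotalOrder; Tri; tri<; tri≈; tri>)
import Relation.Binary.Construct.Flip.EqAndOrd as Flip
open import Relation.Binary.PropositionalEquality
open import Data.List.Relation.Binary.Permutation.Setoid.Properties (setoid ℕ) using (Unique-resp-↭)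

Least : (ℕ → Set) → ℕ → ℕ → Set
Least P n x = 1 ≤ x × x ≤ n × P x × (∀ y → 1 ≤ y → y < x → ¬ P y)

least-or-none : ∀ {P : ℕ → Set} → Decidable P → ∀ n →
  (∀ x → 1 ≤ x → x ≤ n → ¬ P x) ⊎ ∃ (Least P n)
least-or-none P? zero = inj₁ λ x 1≤x x≤0 _ → <⇒≱ 1≤x x≤0
least-or-none {P} P? (suc n) with least-or-none P? n
... | inj₂ (x , 1≤x , x≤n , px , least) = inj₂ (x , 1≤x , m≤n⇒m≤1+n x≤n , px , least)
... | inj₁ none with P? (suc n)
...   | yes p = inj₂ (suc n , s≤s z≤n , ≤-refl , p , λ y 1≤y y<1+n → none y 1≤y (s≤s⁻¹ y<1+n))
...   | no ¬p = inj₁ none′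
  where
  none′ : ∀ x → 1 ≤ x → x ≤ suc n → ¬ P x
  none′ x 1≤x x≤1+n with m≤n⇒m<n∨m≡n x≤1+n
  ... | inj₁ x<1+n = none x 1≤x (s≤s⁻¹ x<1+n)
  ... | inj₂ refl = ¬p

∃-between? : ∀ {P : ℕ → Set} → Decidable P → ∀ m n → Dec (∃[ h ] (m ≤ h × h ≤ n × P h))
∃-between? {P} P? m n = map′ from-fin to-fin (any? λ (h : Fin (suc n)) → (m ≤? toℕ h) ×-dec P? (toℕ h))
  where
  from-fin : (∃ λ (h : Fin (suc n)) → m ≤ toℕ h × P (toℕ h)) → ∃[ h ] (m ≤ h × h ≤ n × P h)
  from-fin (h , m≤h , p) = toℕ h , m≤h , toℕ≤pred[n] h , p
  to-fin : (∃[ h ] (m ≤ h × h ≤ n × P h)) → ∃ λ (h : Fin (suc n)) → m ≤ toℕ h × P (toℕ h)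
  to-fin (h , m≤h , h≤n , p) = fromℕ< (s≤s h≤n) , subst (m ≤_) (sym eq) m≤h , subst P (sym eq) p
    where
    eq : toℕ (fromℕ< (s≤s h≤n)) ≡ h
    eq = toℕ-fromℕ< (s≤s h≤n)

maxUpTo : (ℕ → ℕ) → ℕ → ℕ
maxUpTo f zero = 0
maxUpTo f (suc n) = f (suc n) ⊔ maxUpTo f n

≤-maxUpTo : ∀ f {n x} → 1 ≤ x → x ≤ n → f x ≤ maxUpTo f n
≤-maxUpTo f {zero} 1≤x x≤0 = ⊥-elim (<⇒≱ 1≤x x≤0)
≤-maxUpTo f {suc n} 1≤x x≤1+n with m≤n⇒m<n∨m≡n x≤1+n
... | inj₁ x<1+n = ≤-trans (≤-maxUpTo f 1≤x (s≤s⁻¹ x<1+n)) (m≤n⊔m (f (suc n)) (maxUpTo f n))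
... | inj₂ refl = m≤m⊔n (f (suc n)) (maxUpTo f n)

maxUpTo-< : ∀ f {n B} → 0 < B → (∀ x → 1 ≤ x → x ≤ n → f x < B) → maxUpTo f n < B
maxUpTo-< f {zero} 0<B _ = 0<B
maxUpTo-< f {suc n} 0<B f<B =
  ⊔-lub (f<B (suc n) (s≤s z≤n) ≤-refl) (maxUpTo-< f 0<B λ x 1≤x x≤n → f<B x 1≤x (m≤n⇒m≤1+n x≤n))

threshold : ∀ (u w : ℕ → ℕ) {p r a b} → 1 ≤ p → 1 ≤ r → a ≤ u 1 → w 1 ≤ b →
  (∀ x y → 1 ≤ x → x ≤ p → 1 ≤ y → y ≤ r → u x < w y) →
  ∃[ c ] (a < c × c ≤ b × (∀ x → 1 ≤ x → x ≤ p → u x ≤ c ∸ 1) × (∀ y → 1 ≤ y → y ≤ r → c ≤ w y))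
threshold u w {p} {r} 1≤p 1≤r a≤u₁ w₁≤b u<w =
  suc (maxUpTo u p) , s≤s (≤-trans a≤u₁ (≤-maxUpTo u ≤-refl 1≤p)) , ≤-trans (max<w 1 ≤-refl 1≤r) w₁≤b ,
  (λ x 1≤x x≤p → ≤-maxUpTo u 1≤x x≤p) , max<w
  where
  max<w : ∀ y → 1 ≤ y → y ≤ r → maxUpTo u p < w y
  max<w y 1≤y y≤r = maxUpTo-< u (≤-<-trans z≤n (u<w 1 y ≤-refl 1≤p 1≤y y≤r)) λ x 1≤x x≤p → u<w x y 1≤x x≤p 1≤y y≤r

≤∸⇒+≤ : ∀ {k n ℓ} → k ≤ n → ℓ ≤ n ∸ k → k + ℓ ≤ n
≤∸⇒+≤ {k} {n} {ℓ} k≤n ℓ≤n∸k = subst (_≤ n) (+-comm ℓ k) (m≤o∸n⇒m+n≤o ℓ k≤n ℓ≤n∸k)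

<∸⇒+< : ∀ {k n ℓ} → k ≤ n → ℓ < n ∸ k → k + ℓ < n
<∸⇒+< {k} {n} {ℓ} k≤n ℓ<n∸k = subst (_≤ n) (+-suc k ℓ) (≤∸⇒+≤ k≤n ℓ<n∸k)

m<n⇒m≤n∸1 : ∀ {m n} → m < n → m ≤ n ∸ 1
m<n⇒m≤n∸1 {n = suc n} (s≤s m≤n) = m≤n

m<n⇒n∸1<n : ∀ {m n} → m < n → n ∸ 1 < n
m<n⇒n∸1<n {n = suc n} _ = ≤-refl

m<n≤o⇒n∸1∸m<o∸m : ∀ {m n o} → m < n → n ≤ o → n ∸ 1 ∸ m < o ∸ m
m<n≤o⇒n∸1∸m<o∸m m<n n≤o = ∸-monoˡ-< (<-≤-trans (m<n⇒n∸1<n m<n) n≤o) (m<n⇒m≤n∸1 m<n)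

split-≤ : ∀ {n k x y z} → k ≤ n → k ≤ x → n ∸ k ≤ y → x + y ≤ z → n ≤ z
split-≤ {n} k≤n k≤x n∸k≤y x+y≤z = ≤-trans (≤-reflexive (sym (m+[n∸m]≡n k≤n))) (≤-trans (+-mono-≤ k≤x n∸k≤y) x+y≤z)

Increasing : (ℕ → ℕ) → ℕ → Set
Increasing ι n = ∀ ℓ → 1 ≤ ℓ → ℓ < n → ι ℓ < ι (suc ℓ)

increasing-< : ∀ {ι n ℓ m} → Increasing ι n → 1 ≤ ℓ → ℓ < m → m ≤ n → ι ℓ < ι m
increasing-< {ι} {n} {ℓ} {suc m} inc 1≤ℓ ℓ<1+m 1+m≤n with m≤n⇒m<n∨m≡n (s≤s⁻¹ ℓ<1+m)
... | inj₁ ℓ<m = <-trans (increasing-< inc 1≤ℓ ℓ<m (<⇒≤ 1+m≤n)) (inc m (≤-trans 1≤ℓ (<⇒≤ ℓ<m)) 1+m≤n)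
... | inj₂ refl = inc ℓ 1≤ℓ 1+m≤n

increasing-≤ : ∀ {ι n ℓ m} → Increasing ι n → 1 ≤ ℓ → ℓ ≤ m → m ≤ n → ι ℓ ≤ ι m
increasing-≤ inc 1≤ℓ ℓ≤m m≤n with m≤n⇒m<n∨m≡n ℓ≤m
... | inj₁ ℓ<m = <⇒≤ (increasing-< inc 1≤ℓ ℓ<m m≤n)
... | inj₂ refl = ≤-refl

-- Sequences avoiding 3142 for an arbitrary order

Distinct : (ℕ → ℕ) → ℕ → Set
Distinct f n = ∀ x y → 1 ≤ x → x ≤ n → 1 ≤ y → y ≤ n → f x ≡ f y → x ≡ y

Avoids3142 : Rel ℕ 0ℓ → (ℕ → ℕ) → ℕ → Set
Avoids3142 _≺_ f n = ∀ i₁ i₂ i₃ i₄ → 1 ≤ i₁ → i₁ < i₂ → i₂ < i₃ → i₃ < i₄ → i₄ ≤ n →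
  f i₂ ≺ f i₄ → f i₄ ≺ f i₁ → f i₁ ≺ f i₃ → ⊥

-- 2413 is the complement of 3142: avoiding 2413 is avoiding 3142 for the reversed
-- order, and a ⊖-split for _<_ is a ⊕-split for flip _<_, so the lemmas below are
-- proved once for an arbitrary order.
Avoids2413 : (ℕ → ℕ) → ℕ → Set
Avoids2413 = Avoids3142 (flip _<_)

SeparableFn : (ℕ → ℕ) → ℕ → Set
SeparableFn f n = Distinct f n × Avoids3142 _<_ f n × Avoids2413 f n

SplitsAt : Rel ℕ 0ℓ → (ℕ → ℕ) → ℕ → ℕ → Set
SplitsAt _≺_ f n k = ∀ x y → 1 ≤ x → x ≤ k → k < y → y ≤ n → f x ≺ f y

SumDecomposable : Rel ℕ 0ℓ → (ℕ → ℕ) → ℕ → Set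
SumDecomposable _≺_ f n = ∃[ k ] (1 ≤ k × k < n × (SplitsAt _≺_ f n k ⊎ SplitsAt (flip _≺_) f n k))

Reflects : Rel ℕ 0ℓ → (f g : ℕ → ℕ) → ℕ → Set
Reflects _≺_ f g n = ∀ x y → 1 ≤ x → x ≤ n → 1 ≤ y → y ≤ n → f x ≺ f y → g x ≺ g y

reflects-flip : ∀ {f g n} → Reflects _<_ f g n → Reflects (flip _<_) f g n
reflects-flip reflects x y 1≤x x≤n 1≤y y≤n = reflects y x 1≤y y≤n 1≤x x≤n

Distinct-prefix : ∀ {f n k} → k ≤ n → Distinct f n → Distinct f k
Distinct-prefix k≤n d x y 1≤x x≤k 1≤y y≤k = d x y 1≤x (≤-trans x≤k k≤n) 1≤y (≤-trans y≤k k≤n)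

Distinct-suffix : ∀ {f n k} → k ≤ n → Distinct f n → Distinct (λ ℓ → f (k + ℓ)) (n ∸ k)
Distinct-suffix {k = k} k≤n d x y 1≤x x≤ 1≤y y≤ eq =
  +-cancelˡ-≡ k x y (d (k + x) (k + y) (m≤n⇒m≤o+n k 1≤x) (≤∸⇒+≤ k≤n x≤) (m≤n⇒m≤o+n k 1≤y) (≤∸⇒+≤ k≤n y≤) eq)

Avoids3142-prefix : ∀ {_≺_ f n k} → k ≤ n → Avoids3142 _≺_ f n → Avoids3142 _≺_ f k
Avoids3142-prefix k≤n avoid i₁ i₂ i₃ i₄ 1≤i₁ i₁<i₂ i₂<i₃ i₃<i₄ i₄≤k =
  avoid i₁ i₂ i₃ i₄ 1≤i₁ i₁<i₂ i₂<i₃ i₃<i₄ (≤-trans i₄≤k k≤n)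

Avoids3142-suffix : ∀ {_≺_ f n k} → k ≤ n → Avoids3142 _≺_ f n → Avoids3142 _≺_ (λ ℓ → f (k + ℓ)) (n ∸ k)
Avoids3142-suffix {k = k} k≤n avoid i₁ i₂ i₃ i₄ 1≤i₁ i₁<i₂ i₂<i₃ i₃<i₄ i₄≤ =
  avoid (k + i₁) (k + i₂) (k + i₃) (k + i₄) (m≤n⇒m≤o+n k 1≤i₁)
    (+-monoʳ-< k i₁<i₂) (+-monoʳ-< k i₂<i₃) (+-monoʳ-< k i₃<i₄) (≤∸⇒+≤ k≤n i₄≤)

SeparableFn-prefix : ∀ {f n k} → k ≤ n → SeparableFn f n → SeparableFn f k
SeparableFn-prefix k≤n (distinct , avoid3142 , avoid2413) =
  Distinct-prefix k≤n distinct , Avoids3142-prefix {_<_} k≤n avoid3142 , Avoids3142-prefix {flip _<_} k≤n avoid2413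

SeparableFn-suffix : ∀ {f n k} → k ≤ n → SeparableFn f n → SeparableFn (λ ℓ → f (k + ℓ)) (n ∸ k)
SeparableFn-suffix k≤n (distinct , avoid3142 , avoid2413) =
  Distinct-suffix k≤n distinct , Avoids3142-suffix {_<_} k≤n avoid3142 , Avoids3142-suffix {flip _<_} k≤n avoid2413

Avoids3142-reflect : ∀ {_≺_ f g n} → Reflects _≺_ f g n → Avoids3142 _≺_ g n → Avoids3142 _≺_ f n
Avoids3142-reflect {n = n} reflects avoid i₁ i₂ i₃ i₄ 1≤i₁ i₁<i₂ i₂<i₃ i₃<i₄ i₄≤n r₁ r₂ r₃ =
  avoid i₁ i₂ i₃ i₄ 1≤i₁ i₁<i₂ i₂<i₃ i₃<i₄ i₄≤n
    (reflects i₂ i₄ 1≤i₂ i₂≤n 1≤i₄ i₄≤n r₁) (reflects i₄ i₁ 1≤i₄ i₄≤n 1≤i₁ i₁≤n r₂)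
    (reflects i₁ i₃ 1≤i₁ i₁≤n 1≤i₃ i₃≤n r₃)
  where
  i₃≤n : i₃ ≤ n
  i₃≤n = ≤-trans (<⇒≤ i₃<i₄) i₄≤n
  i₂≤n : i₂ ≤ n
  i₂≤n = ≤-trans (<⇒≤ i₂<i₃) i₃≤n
  i₁≤n : i₁ ≤ n
  i₁≤n = ≤-trans (<⇒≤ i₁<i₂) i₂≤n
  1≤i₂ : 1 ≤ i₂
  1≤i₂ = ≤-trans 1≤i₁ (<⇒≤ i₁<i₂)
  1≤i₃ : 1 ≤ i₃
  1≤i₃ = ≤-trans 1≤i₂ (<⇒≤ i₂<i₃)
  1≤i₄ : 1 ≤ i₄
  1≤i₄ = ≤-trans 1≤i₃ (<⇒≤ i₃<i₄)

Straddling3142Free : Rel ℕ 0ℓ → (ℕ → ℕ) → ℕ → ℕ → Set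
Straddling3142Free _≺_ f n k = ∀ i₁ i₂ i₃ i₄ → 1 ≤ i₁ → i₁ < i₂ → i₂ < i₃ → i₃ < i₄ → i₄ ≤ n →
  i₁ ≤ k → k < i₄ → f i₂ ≺ f i₄ → f i₄ ≺ f i₁ → f i₁ ≺ f i₃ → ⊥

Avoids3142-glue : ∀ {_≺_ f n k} → k ≤ n → Avoids3142 _≺_ f k →
  Avoids3142 _≺_ (λ ℓ → f (k + ℓ)) (n ∸ k) → Straddling3142Free _≺_ f n k → Avoids3142 _≺_ f n
Avoids3142-glue {_≺_} {f} {n} {k} k≤n prefix suffix straddle i₁ i₂ i₃ i₄ 1≤i₁ i₁<i₂ i₂<i₃ i₃<i₄ i₄≤n
  with i₄ ≤? k | i₁ ≤? k
... | yes i₄≤k | _ = prefix i₁ i₂ i₃ i₄ 1≤i₁ i₁<i₂ i₂<i₃ i₃<i₄ i₄≤k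
... | no i₄≰k | yes i₁≤k = straddle i₁ i₂ i₃ i₄ 1≤i₁ i₁<i₂ i₂<i₃ i₃<i₄ i₄≤n i₁≤k (≰⇒> i₄≰k)
... | no _ | no i₁≰k = λ r₁ r₂ r₃ →
  suffix (i₁ ∸ k) (i₂ ∸ k) (i₃ ∸ k) (i₄ ∸ k) (m<n⇒0<n∸m k<i₁)
    (∸-monoˡ-< i₁<i₂ k≤i₁) (∸-monoˡ-< i₂<i₃ (≤-trans k≤i₁ (<⇒≤ i₁<i₂)))
    (∸-monoˡ-< i₃<i₄ (≤-trans k≤i₁ (<⇒≤ (<-trans i₁<i₂ i₂<i₃)))) (∸-monoˡ-≤ k i₄≤n)
    (subst₂ _≺_ (unshift (<-trans k<i₁ i₁<i₂)) (unshift k<i₄) r₁)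
    (subst₂ _≺_ (unshift k<i₄) (unshift k<i₁) r₂)
    (subst₂ _≺_ (unshift k<i₁) (unshift (<-trans k<i₁ (<-trans i₁<i₂ i₂<i₃))) r₃)
  where
  k<i₁ : k < i₁
  k<i₁ = ≰⇒> i₁≰k
  k≤i₁ : k ≤ i₁
  k≤i₁ = <⇒≤ k<i₁
  k<i₄ : k < i₄
  k<i₄ = <-trans k<i₁ (<-trans i₁<i₂ (<-trans i₂<i₃ i₃<i₄))
  unshift : ∀ {i} → k < i → f i ≡ f (k + (i ∸ k))
  unshift k<i = cong f (sym (m+[n∸m]≡n (<⇒≤ k<i)))

straddling3142Free-⊕ : ∀ {_≺_ f n k} → Asymmetric _≺_ → SplitsAt _≺_ f n k → Straddling3142Free _≺_ f n k
straddling3142Free-⊕ asym split i₁ _ _ i₄ 1≤i₁ _ _ _ i₄≤n i₁≤k k<i₄ _ r₂ _ =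
  asym (split i₁ i₄ 1≤i₁ i₁≤k k<i₄ i₄≤n) r₂

straddling3142Free-⊖ : ∀ {_≺_ f n k} → Asymmetric _≺_ → SplitsAt (flip _≺_) f n k →
  Straddling3142Free _≺_ f n k
straddling3142Free-⊖ {k = k} asym split i₁ i₂ i₃ i₄ 1≤i₁ i₁<i₂ i₂<i₃ i₃<i₄ i₄≤n i₁≤k k<i₄ r₁ r₂ r₃
  with i₂ ≤? k
... | yes i₂≤k = asym r₁ (split i₂ i₄ (≤-trans 1≤i₁ (<⇒≤ i₁<i₂)) i₂≤k k<i₄ i₄≤n)
... | no i₂≰k = asym r₃ (split i₁ i₃ 1≤i₁ i₁≤k (<-trans (≰⇒> i₂≰k) i₂<i₃) (≤-trans (<⇒≤ i₃<i₄) i₄≤n))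

Avoids3142-sum : ∀ {_≺_ f n k} → Asymmetric _≺_ → k ≤ n → SplitsAt _≺_ f n k ⊎ SplitsAt (flip _≺_) f n k →
  Avoids3142 _≺_ f k → Avoids3142 _≺_ (λ ℓ → f (k + ℓ)) (n ∸ k) → Avoids3142 _≺_ f n
Avoids3142-sum {_≺_} asym k≤n (inj₁ split) prefix suffix =
  Avoids3142-glue {_≺_} k≤n prefix suffix (straddling3142Free-⊕ {_≺_} asym split)
Avoids3142-sum {_≺_} asym k≤n (inj₂ split) prefix suffix =
  Avoids3142-glue {_≺_} k≤n prefix suffix (straddling3142Free-⊖ {_≺_} asym split)

-- Sum decomposition

splitsAt-last : ∀ {_≺_ f m} → (∀ x → 1 ≤ x → x ≤ m → f x ≺ f (suc m)) → SplitsAt _≺_ f (suc m) m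
splitsAt-last below x y 1≤x x≤m m<y y≤1+m with ≤-antisym y≤1+m m<y
... | refl = below x 1≤x x≤m

splitsAt-extend : ∀ {_≺_ f m p} → (∀ x → 1 ≤ x → x ≤ p → f x ≺ f (suc m)) →
  SplitsAt _≺_ f m p → SplitsAt _≺_ f (suc m) p
splitsAt-extend below split x y 1≤x x≤p p<y y≤1+m with m≤n⇒m<n∨m≡n y≤1+m
... | inj₁ y<1+m = split x y 1≤x x≤p p<y (s≤s⁻¹ y<1+m)
... | inj₂ refl = below x 1≤x x≤p

module SumExtension {_≺_ : Rel ℕ 0ℓ} (sto : IsStrictTotalOrder _≡_ _≺_) where

  open IsStrictTotalOrder sto using () renaming (trans to ≺-trans; compare to ≺-compare; _<?_ to _≺?_)

  ≺-of-≢ : ∀ {u v} → u ≢ v → ¬ v ≺ u → u ≺ v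
  ≺-of-≢ {u} {v} u≢v v⊀u with ≺-compare u v
  ... | tri< u≺v _ _ = u≺v
  ... | tri≈ _ u≡v _ = ⊥-elim (u≢v u≡v)
  ... | tri> _ _ v≺u = ⊥-elim (v⊀u v≺u)

  module _ {f : ℕ → ℕ} {m : ℕ} (distinct : Distinct f (suc m)) where

    ≢-last : ∀ {x} → 1 ≤ x → x ≤ m → f x ≢ f (suc m)
    ≢-last 1≤x x≤m eq = <⇒≢ (s≤s x≤m) (distinct _ (suc m) 1≤x (m≤n⇒m≤1+n x≤m) (s≤s z≤n) ≤-refl eq)

    below-last : ∀ {x} → 1 ≤ x → x ≤ m → ¬ f (suc m) ≺ f x → f x ≺ f (suc m)
    below-last 1≤x x≤m = ≺-of-≢ (≢-last 1≤x x≤m)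

    above-last : ∀ {x} → 1 ≤ x → x ≤ m → ¬ f x ≺ f (suc m) → f (suc m) ≺ f x
    above-last 1≤x x≤m = ≺-of-≢ (λ eq → ≢-last 1≤x x≤m (sym eq))

    -- A later value below f (m+1) would complete a 3142 with h, k+1 and m+1.
    above-from-least : ∀ {k h} → Avoids3142 _≺_ f (suc m) → k < m → SplitsAt _≺_ f m k →
      Least (λ x → f (suc m) ≺ f x) m h → h ≤ k → ∀ y → h ≤ y → y ≤ m → f (suc m) ≺ f y
    above-from-least {k} {h} avoid k<m split (1≤h , _ , v≺fh , _) h≤k y h≤y y≤m with m≤n⇒m<n∨m≡n h≤y
    ... | inj₂ refl = v≺fh
    ... | inj₁ h<y with y ≤? k
    ...   | no y≰k = ≺-trans v≺fh (split h y 1≤h h≤k (≰⇒> y≰k) y≤m)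
    ...   | yes y≤k = above-last (≤-trans 1≤h (<⇒≤ h<y)) y≤m λ fy≺v →
      avoid h y (suc k) (suc m) 1≤h h<y (s≤s y≤k) (s≤s k<m) ≤-refl fy≺v v≺fh (split h (suc k) 1≤h h≤k ≤-refl k<m)

    split-before-least : ∀ {h} → 1 ≤ m → Least (λ x → f (suc m) ≺ f x) m h →
      (∀ y → h ≤ y → y ≤ m → f (suc m) ≺ f y) → SumDecomposable _≺_ f (suc m)
    split-before-least {suc zero} 1≤m _ above =
      m , 1≤m , ≤-refl , inj₂ (splitsAt-last {flip _≺_} λ x 1≤x x≤m → above x 1≤x x≤m)
    split-before-least {suc (suc h)} _ (_ , h≤m , _ , minimal) above =
      suc h , s≤s z≤n , m≤n⇒m≤1+n h≤m , inj₁ (splitsAt-extend {_≺_} prefix-below λ x y 1≤x x≤h h<y y≤m →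
        ≺-trans (prefix-below x 1≤x x≤h) (above y h<y y≤m))
      where
      prefix-below : ∀ x → 1 ≤ x → x ≤ suc h → f x ≺ f (suc m)
      prefix-below x 1≤x x≤h = below-last 1≤x (≤-trans x≤h (<⇒≤ h≤m)) (minimal x 1≤x (s≤s x≤h))

    extend : ∀ {k} → Avoids3142 _≺_ f (suc m) → 1 ≤ k → k < m → SplitsAt _≺_ f m k →
      SumDecomposable _≺_ f (suc m)
    extend {k} avoid 1≤k k<m split with least-or-none (λ x → f (suc m) ≺? f x) m
    ... | inj₁ none = m , 1≤m , ≤-refl ,
      inj₁ (splitsAt-last {_≺_} λ x 1≤x x≤m → below-last 1≤x x≤m (none x 1≤x x≤m))
      where
      1≤m : 1 ≤ m
      1≤m = ≤-trans 1≤k (<⇒≤ k<m)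
    ... | inj₂ (h , least@(1≤h , h≤m , _ , minimal)) with k <? h
    ...   | yes k<h = k , 1≤k , m<n⇒m<1+n k<m , inj₁ (splitsAt-extend {_≺_} prefix-below split)
      where
      prefix-below : ∀ x → 1 ≤ x → x ≤ k → f x ≺ f (suc m)
      prefix-below x 1≤x x≤k = below-last 1≤x (≤-trans x≤k (<⇒≤ k<m)) (minimal x 1≤x (≤-<-trans x≤k k<h))
    ...   | no k≮h = split-before-least (≤-trans 1≤k (<⇒≤ k<m)) least
      (above-from-least avoid k<m split least (≮⇒≥ k≮h))

sumDecomposable : ∀ {_≺_} → IsStrictTotalOrder _≡_ _≺_ → ∀ {f} n → 2 ≤ n → Distinct f n →
  Avoids3142 _≺_ f n → Avoids3142 (flip _≺_) f n → SumDecomposable _≺_ f n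
sumDecomposable sto (suc zero) (s≤s ())
sumDecomposable {_≺_} sto {f} (suc (suc zero)) _ distinct _ _ with IsStrictTotalOrder.compare sto (f 1) (f 2)
... | tri< f₁≺f₂ _ _ = 1 , ≤-refl , ≤-refl , inj₁ (splitsAt-last {_≺_} λ { 1 _ _ → f₁≺f₂ ; (suc (suc _)) _ (s≤s ()) })
... | tri> _ _ f₂≺f₁ = 1 , ≤-refl , ≤-refl , inj₂ (splitsAt-last {flip _≺_} λ { 1 _ _ → f₂≺f₁ ; (suc (suc _)) _ (s≤s ()) })
... | tri≈ _ f₁≡f₂ _ with distinct 1 2 ≤-refl (s≤s z≤n) (s≤s z≤n) ≤-refl f₁≡f₂
...   | ()
sumDecomposable {_≺_} sto (suc (suc (suc m))) _ distinct avoid avoidᶠ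
  with sumDecomposable sto (suc (suc m)) (s≤s (s≤s z≤n)) (Distinct-prefix (n≤1+n _) distinct)
         (Avoids3142-prefix {_≺_} (n≤1+n _) avoid) (Avoids3142-prefix {flip _≺_} (n≤1+n _) avoidᶠ)
... | k , 1≤k , k<m , inj₁ split = SumExtension.extend sto distinct avoid 1≤k k<m split
... | k , 1≤k , k<m , inj₂ split =
  map₂ (map₂ (map₂ swap)) (SumExtension.extend (Flip.isStrictTotalOrder sto) distinct avoidᶠ 1≤k k<m split)

-- Permutations and their direct and skew sums

!-∈ : ∀ p {x} → 1 ≤ x → x ≤ length p → p ! x ∈ p
!-∈ (y ∷ p) {suc zero} _ _ = here refl
!-∈ (y ∷ p) {suc (suc x)} _ (s≤s x<) = there (!-∈ p (s≤s z≤n) x<)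

!-++ˡ : ∀ p q {x} → 1 ≤ x → x ≤ length p → (p ++ q) ! x ≡ p ! x
!-++ˡ (y ∷ p) q {suc zero} _ _ = refl
!-++ˡ (y ∷ p) q {suc (suc x)} _ (s≤s x<) = !-++ˡ p q (s≤s z≤n) x<

!-∷ : ∀ z p {x} → 1 ≤ x → (z ∷ p) ! suc x ≡ p ! x
!-∷ z p {suc x} _ = refl

!-++ʳ : ∀ p q {y} → 1 ≤ y → (p ++ q) ! (length p + y) ≡ q ! y
!-++ʳ [] q _ = refl
!-++ʳ (z ∷ p) q 1≤y = trans (!-∷ z (p ++ q) (m≤n⇒m≤o+n (length p) 1≤y)) (!-++ʳ p q 1≤y)

!-map : ∀ (g : ℕ → ℕ) p {x} → 1 ≤ x → x ≤ length p → map g p ! x ≡ g (p ! x)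
!-map g (y ∷ p) {suc zero} _ _ = refl
!-map g (y ∷ p) {suc (suc x)} _ (s≤s x<) = !-map g p (s≤s z≤n) x<

Unique⇒Distinct : ∀ p → Unique p → Distinct (p !_) (length p)
Unique⇒Distinct (z ∷ p) _ (suc zero) (suc zero) _ _ _ _ _ = refl
Unique⇒Distinct (z ∷ p) (z∉p ∷ _) (suc zero) (suc (suc y)) _ _ _ (s≤s y<) eq =
  ⊥-elim (All.lookup z∉p (!-∈ p (s≤s z≤n) y<) eq)
Unique⇒Distinct (z ∷ p) (z∉p ∷ _) (suc (suc x)) (suc zero) _ (s≤s x<) _ _ eq =
  ⊥-elim (All.lookup z∉p (!-∈ p (s≤s z≤n) x<) (sym eq))
Unique⇒Distinct (z ∷ p) (_ ∷ unique) (suc (suc x)) (suc (suc y)) _ (s≤s x<) _ (s≤s y<) eq =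
  cong suc (Unique⇒Distinct p unique (suc x) (suc y) (s≤s z≤n) x< (s≤s z≤n) y< eq)

perm-distinct : ∀ {p} → IsPerm p → Distinct (p !_) (length p)
perm-distinct {p} perm =
  Unique⇒Distinct p (Unique-resp-↭ (↭⇒↭ₛ (↭-sym perm)) (Unique.map⁺ suc-injective (Unique.upTo⁺ (length p))))

perm-bounds : ∀ {p x} → IsPerm p → 1 ≤ x → x ≤ length p → 1 ≤ p ! x × p ! x ≤ length p
perm-bounds {p} perm 1≤x x≤ with ∈-map⁻ suc (∈-resp-↭ perm (!-∈ p 1≤x x≤))
... | y , y∈ , eq rewrite eq = s≤s z≤n , ∈-upTo⁻ y∈

applyUpTo-+ : ∀ (f : ℕ → ℕ) m n → applyUpTo f (m + n) ≡ applyUpTo f m ++ applyUpTo (f ∘ (m +_)) n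
applyUpTo-+ f zero n = refl
applyUpTo-+ f (suc m) n = cong (f 0 ∷_) (applyUpTo-+ (f ∘ suc) m n)

range-+ : ∀ k k′ → range (k + k′) ≡ range k ++ map (_+ k) (range k′)
range-+ k k′ = begin
  range (k + k′)                                  ≡⟨ map-upTo suc (k + k′) ⟩
  applyUpTo suc (k + k′)                          ≡⟨ applyUpTo-+ suc k k′ ⟩
  applyUpTo suc k ++ applyUpTo (suc ∘ (k +_)) k′  ≡⟨ cong₂ _++_ (sym (map-upTo suc k)) (sym shifted) ⟩
  range k ++ map (_+ k) (range k′)                ∎
  where
  open ≡-Reasoning
  shifted : map (_+ k) (range k′) ≡ applyUpTo (suc ∘ (k +_)) k′
  shifted = trans (sym (map-∘ (upTo k′)))
    (trans (map-cong (λ x → cong suc (+-comm x k)) (upTo k′)) (map-upTo (suc ∘ (k +_)) k′))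

length-⊕ : ∀ p q → length (p ⊕ q) ≡ length p + length q
length-⊕ p q = trans (length-++ p) (cong (length p +_) (length-map (_+ length p) q))

length-⊖ : ∀ p q → length (p ⊖ q) ≡ length p + length q
length-⊖ p q = trans (length-++ (map (_+ length q) p)) (cong (_+ length q) (length-map (_+ length q) p))

perm-⊕ : ∀ {p q} → IsPerm p → IsPerm q → IsPerm (p ⊕ q)
perm-⊕ {p} {q} perm-p perm-q rewrite length-⊕ p q | range-+ (length p) (length q) =
  ++⁺ perm-p (Perm.map⁺ (_+ length p) perm-q)

perm-⊖ : ∀ {p q} → IsPerm p → IsPerm q → IsPerm (p ⊖ q)
perm-⊖ {p} {q} perm-p perm-q
  rewrite length-⊖ p q | +-comm (length p) (length q) | range-+ (length q) (length p) =
  ↭-trans (++⁺ (Perm.map⁺ (_+ length q) perm-p) perm-q) (++-comm (map (_+ length q) (range (length p))) _)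

record ShiftedConcat (S A : List ℕ) (cA : ℕ) (B : List ℕ) (cB : ℕ) : Set where
  constructor shiftedConcat
  field
    length-≡ : length S ≡ length A + length B
    prefix   : ∀ x → 1 ≤ x → x ≤ length A → S ! x ≡ A ! x + cA
    suffix   : ∀ y → 1 ≤ y → y ≤ length B → S ! (length A + y) ≡ B ! y + cB

⊕-shifted : ∀ A B → ShiftedConcat (A ⊕ B) A 0 B (length A)
⊕-shifted A B = shiftedConcat (length-⊕ A B)
  (λ x 1≤x x≤ → trans (!-++ˡ A _ 1≤x x≤) (sym (+-identityʳ _)))
  (λ y 1≤y y≤ → trans (!-++ʳ A _ 1≤y) (!-map (_+ length A) B 1≤y y≤))

⊖-shifted : ∀ A B → ShiftedConcat (A ⊖ B) A (length B) B 0
⊖-shifted A B = shiftedConcat (length-⊖ A B)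
  (λ x 1≤x x≤ → trans (!-++ˡ shiftedA B 1≤x (subst (x ≤_) (sym (length-map _ A)) x≤)) (!-map _ A 1≤x x≤))
  (λ y 1≤y y≤ → trans (cong (λ t → (shiftedA ++ B) ! (t + y)) (sym (length-map _ A)))
                      (trans (!-++ʳ shiftedA B 1≤y) (sym (+-identityʳ _))))
  where
  shiftedA : List ℕ
  shiftedA = map (_+ length B) A

shifted-prefix-reflects : ∀ {S A cA B cB} → ShiftedConcat S A cA B cB → Reflects _<_ (S !_) (A !_) (length A)
shifted-prefix-reflects {cA = cA} (shiftedConcat _ prefix _) x y 1≤x x≤ 1≤y y≤ Sx<Sy =
  +-cancelʳ-< cA _ _ (subst₂ _<_ (prefix x 1≤x x≤) (prefix y 1≤y y≤) Sx<Sy)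

shifted-suffix-reflects : ∀ {S A cA B cB} → ShiftedConcat S A cA B cB →
  Reflects _<_ (λ y → S ! (length A + y)) (B !_) (length B)
shifted-suffix-reflects {cB = cB} (shiftedConcat _ _ suffix) x y 1≤x x≤ 1≤y y≤ Sx<Sy =
  +-cancelʳ-< cB _ _ (subst₂ _<_ (suffix x 1≤x x≤) (suffix y 1≤y y≤) Sx<Sy)

shifted-splitsAt : ∀ {_≺_ S A cA B cB} → ShiftedConcat S A cA B cB →
  (∀ x y → 1 ≤ x → x ≤ length A → 1 ≤ y → y ≤ length B → (A ! x + cA) ≺ (B ! y + cB)) →
  SplitsAt _≺_ (S !_) (length S) (length A)
shifted-splitsAt {_≺_} {S} {A} {B = B} (shiftedConcat len prefix suffix) A≺B x y 1≤x x≤ A<y y≤S =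
  subst₂ _≺_ (sym (prefix x 1≤x x≤)) (trans (sym (suffix d 1≤d d≤)) (cong (S !_) (m+[n∸m]≡n (<⇒≤ A<y))))
    (A≺B x d 1≤x x≤ 1≤d d≤)
  where
  d : ℕ
  d = y ∸ length A
  1≤d : 1 ≤ d
  1≤d = m<n⇒0<n∸m A<y
  d≤ : d ≤ length B
  d≤ = m≤n+o⇒m∸n≤o y (length A) (subst (y ≤_) len y≤S)

⊕-values-< : ∀ {A B} → IsPerm A → IsPerm B →
  ∀ x y → 1 ≤ x → x ≤ length A → 1 ≤ y → y ≤ length B → A ! x + 0 < B ! y + length A
⊕-values-< {A} perm-A perm-B x y 1≤x x≤ 1≤y y≤ =
  ≤-<-trans (≤-trans (≤-reflexive (+-identityʳ _)) (proj₂ (perm-bounds perm-A 1≤x x≤)))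
            (+-monoˡ-≤ (length A) (proj₁ (perm-bounds perm-B 1≤y y≤)))

⊖-values-< : ∀ {A B} → IsPerm A → IsPerm B →
  ∀ x y → 1 ≤ x → x ≤ length A → 1 ≤ y → y ≤ length B → B ! y + 0 < A ! x + length B
⊖-values-< {A} {B} perm-A perm-B x y 1≤x x≤ 1≤y y≤ =
  ≤-<-trans (≤-trans (≤-reflexive (+-identityʳ _)) (proj₂ (perm-bounds perm-B 1≤y y≤)))
            (+-monoˡ-≤ (length B) (proj₁ (perm-bounds perm-A 1≤x x≤)))

⊕-splitsAt : ∀ {A B} → IsPerm A → IsPerm B → SplitsAt _<_ ((A ⊕ B) !_) (length (A ⊕ B)) (length A)
⊕-splitsAt {A} {B} perm-A perm-B = shifted-splitsAt {_<_} (⊕-shifted A B) (⊕-values-< perm-A perm-B)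

⊖-splitsAt : ∀ {A B} → IsPerm A → IsPerm B → SplitsAt (flip _<_) ((A ⊖ B) !_) (length (A ⊖ B)) (length A)
⊖-splitsAt {A} {B} perm-A perm-B = shifted-splitsAt {flip _<_} (⊖-shifted A B) (⊖-values-< perm-A perm-B)

-- Occurrences

InBox : List ℕ → (i j a b : ℕ) → ℕ → Set
InBox σ i j a b p = 1 ≤ p × p ≤ length σ × i ≤ p × p ≤ j × a ≤ σ ! p × σ ! p ≤ b

-- OccursUsing π σ is OccursUsingFn (π !_) (length π) σ by definition; patterns given as
-- functions let the prefix and the shifted suffix of a pattern occur without being
-- standardised to permutations.
OccursUsingFn : (ℕ → ℕ) → ℕ → List ℕ → (i j a b : ℕ) → Set
OccursUsingFn f n σ i j a b = Σ (ℕ → ℕ) λ ι → Increasing ι n ×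
  (∀ ℓ → 1 ≤ ℓ → ℓ ≤ n → InBox σ i j a b (ι ℓ)) ×
  (∀ ℓ m → 1 ≤ ℓ → ℓ ≤ n → 1 ≤ m → m ≤ n → f ℓ < f m → σ ! ι ℓ < σ ! ι m)

data Side (k ℓ : ℕ) : Set where
  left  : ℓ ≤ k → Side k ℓ
  right : ∀ d → 1 ≤ d → ℓ ≡ k + d → Side k ℓ

side : ∀ k ℓ → Side k ℓ
side k ℓ with ℓ ≤? k
... | yes ℓ≤k = left ℓ≤k
... | no ℓ≰k = right (ℓ ∸ k) (m<n⇒0<n∸m (≰⇒> ℓ≰k)) (sym (m+[n∸m]≡n (<⇒≤ (≰⇒> ℓ≰k))))

juxtapose : ℕ → (ℕ → ℕ) → (ℕ → ℕ) → ℕ → ℕ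
juxtapose k ι₁ ι₂ ℓ with ℓ ≤? k
... | yes _ = ι₁ ℓ
... | no _ = ι₂ (ℓ ∸ k)

juxtapose-left : ∀ k ι₁ ι₂ {ℓ} → ℓ ≤ k → juxtapose k ι₁ ι₂ ℓ ≡ ι₁ ℓ
juxtapose-left k ι₁ ι₂ {ℓ} ℓ≤k with ℓ ≤? k
... | yes _ = refl
... | no ℓ≰k = ⊥-elim (ℓ≰k ℓ≤k)

juxtapose-right : ∀ k ι₁ ι₂ {d} → 1 ≤ d → juxtapose k ι₁ ι₂ (k + d) ≡ ι₂ d
juxtapose-right k ι₁ ι₂ {d} 1≤d with k + d ≤? k
... | yes k+d≤k = ⊥-elim (<⇒≱ (m<m+n k 1≤d) k+d≤k)
... | no _ = cong ι₂ (m+n∸m≡n k d)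

juxtapose-increasing : ∀ {ι₁ ι₂ k₁ k₂} → Increasing ι₁ k₁ → Increasing ι₂ k₂ →
  (∀ ℓ d → 1 ≤ ℓ → ℓ ≤ k₁ → 1 ≤ d → d ≤ k₂ → ι₁ ℓ < ι₂ d) → Increasing (juxtapose k₁ ι₁ ι₂) (k₁ + k₂)
juxtapose-increasing {ι₁} {ι₂} {k₁} {k₂} inc₁ inc₂ before ℓ 1≤ℓ ℓ< with side k₁ ℓ
... | right d 1≤d refl =
  subst₂ _<_ (sym (juxtapose-right k₁ ι₁ ι₂ 1≤d))
    (sym (trans (cong (juxtapose k₁ ι₁ ι₂) (sym (+-suc k₁ d))) (juxtapose-right k₁ ι₁ ι₂ (s≤s z≤n))))
    (inc₂ d 1≤d (+-cancelˡ-< k₁ d k₂ ℓ<))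
... | left ℓ≤k₁ with side k₁ (suc ℓ)
...   | left 1+ℓ≤k₁ =
  subst₂ _<_ (sym (juxtapose-left k₁ ι₁ ι₂ ℓ≤k₁)) (sym (juxtapose-left k₁ ι₁ ι₂ 1+ℓ≤k₁)) (inc₁ ℓ 1≤ℓ 1+ℓ≤k₁)
...   | right d 1≤d 1+ℓ≡k₁+d =
  subst₂ _<_ (sym (juxtapose-left k₁ ι₁ ι₂ ℓ≤k₁))
    (sym (trans (cong (juxtapose k₁ ι₁ ι₂) 1+ℓ≡k₁+d) (juxtapose-right k₁ ι₁ ι₂ 1≤d)))
    (before ℓ d 1≤ℓ ℓ≤k₁ 1≤d (+-cancelˡ-≤ k₁ d k₂ (subst (_≤ k₁ + k₂) 1+ℓ≡k₁+d ℓ<)))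

record DirectParts (σ : List ℕ) (f : ℕ → ℕ) (n k i j a b : ℕ) : Set where
  field
    h c    : ℕ
    cut    : i < h × h ≤ j × a < c × c ≤ b
    prefix : OccursUsingFn f k σ i (h ∸ 1) a (c ∸ 1)
    suffix : OccursUsingFn (λ ℓ → f (k + ℓ)) (n ∸ k) σ h j c b

record SkewParts (σ : List ℕ) (f : ℕ → ℕ) (n k i j a b : ℕ) : Set where
  field
    h c    : ℕ
    cut    : i < h × h ≤ j × a < c × c ≤ b
    prefix : OccursUsingFn f k σ i (h ∸ 1) c b
    suffix : OccursUsingFn (λ ℓ → f (k + ℓ)) (n ∸ k) σ h j a (c ∸ 1)

module _ (σ : List ℕ) where

  position-≥ : ∀ {i j a b p} → InBox σ i j a b p → i ≤ p
  position-≥ = proj₁ ∘ proj₂ ∘ proj₂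

  position-≤ : ∀ {i j a b p} → InBox σ i j a b p → p ≤ j
  position-≤ = proj₁ ∘ proj₂ ∘ proj₂ ∘ proj₂

  value-≥ : ∀ {i j a b p} → InBox σ i j a b p → a ≤ σ ! p
  value-≥ = proj₁ ∘ proj₂ ∘ proj₂ ∘ proj₂ ∘ proj₂

  value-≤ : ∀ {i j a b p} → InBox σ i j a b p → σ ! p ≤ b
  value-≤ = proj₂ ∘ proj₂ ∘ proj₂ ∘ proj₂ ∘ proj₂

  occurs-reflect : ∀ {f g n i j a b} → Reflects _<_ f g n → OccursUsingFn g n σ i j a b → OccursUsingFn f n σ i j a b
  occurs-reflect reflects (ι , inc , bounds , order) =
    ι , inc , bounds , λ ℓ m 1≤ℓ ℓ≤n 1≤m m≤n fℓ<fm → order ℓ m 1≤ℓ ℓ≤n 1≤m m≤n (reflects ℓ m 1≤ℓ ℓ≤n 1≤m m≤n fℓ<fm)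

  occurs-concat : ∀ {f k₁ k₂ i h′ h j a b a₁ b₁ a₂ b₂} →
    OccursUsingFn f k₁ σ i h′ a₁ b₁ → OccursUsingFn (λ ℓ → f (k₁ + ℓ)) k₂ σ h j a₂ b₂ →
    h′ < h → i ≤ h → h′ ≤ j → a ≤ a₁ → b₁ ≤ b → a ≤ a₂ → b₂ ≤ b →
    (∀ ℓ m → 1 ≤ ℓ → ℓ ≤ k₁ → 1 ≤ m → m ≤ k₂ → f ℓ < f (k₁ + m) → b₁ < a₂) →
    (∀ ℓ m → 1 ≤ ℓ → ℓ ≤ k₁ → 1 ≤ m → m ≤ k₂ → f (k₁ + m) < f ℓ → b₂ < a₁) →
    OccursUsingFn f (k₁ + k₂) σ i j a b
  occurs-concat {f} {k₁} {k₂} {i} {h′} {h} {j} {a} {b} {a₁} {b₁} {a₂} {b₂}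
    (ι₁ , inc₁ , bounds₁ , order₁) (ι₂ , inc₂ , bounds₂ , order₂) h′<h i≤h h′≤j a≤a₁ b₁≤b a≤a₂ b₂≤b up down =
    ι , juxtapose-increasing inc₁ inc₂ before , bounds , order
    where
    ι : ℕ → ℕ
    ι = juxtapose k₁ ι₁ ι₂
    before : ∀ ℓ d → 1 ≤ ℓ → ℓ ≤ k₁ → 1 ≤ d → d ≤ k₂ → ι₁ ℓ < ι₂ d
    before ℓ d 1≤ℓ ℓ≤k₁ 1≤d d≤k₂ =
      ≤-<-trans (position-≤ (bounds₁ ℓ 1≤ℓ ℓ≤k₁)) (<-≤-trans h′<h (position-≥ (bounds₂ d 1≤d d≤k₂)))
    bounds : ∀ ℓ → 1 ≤ ℓ → ℓ ≤ k₁ + k₂ → InBox σ i j a b (ι ℓ)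
    bounds ℓ 1≤ℓ ℓ≤ with side k₁ ℓ
    ... | left ℓ≤k₁ rewrite juxtapose-left k₁ ι₁ ι₂ ℓ≤k₁ =
      let (p₁ , p₂ , p₃ , p₄ , p₅ , p₆) = bounds₁ ℓ 1≤ℓ ℓ≤k₁
      in p₁ , p₂ , p₃ , ≤-trans p₄ h′≤j , ≤-trans a≤a₁ p₅ , ≤-trans p₆ b₁≤b
    ... | right d 1≤d refl rewrite juxtapose-right k₁ ι₁ ι₂ 1≤d =
      let (p₁ , p₂ , p₃ , p₄ , p₅ , p₆) = bounds₂ d 1≤d (+-cancelˡ-≤ k₁ d k₂ ℓ≤)
      in p₁ , p₂ , ≤-trans i≤h p₃ , p₄ , ≤-trans a≤a₂ p₅ , ≤-trans p₆ b₂≤b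
    order : ∀ ℓ m → 1 ≤ ℓ → ℓ ≤ k₁ + k₂ → 1 ≤ m → m ≤ k₁ + k₂ → f ℓ < f m → σ ! ι ℓ < σ ! ι m
    order ℓ m 1≤ℓ ℓ≤ 1≤m m≤ fℓ<fm with side k₁ ℓ | side k₁ m
    ... | left ℓ≤k₁ | left m≤k₁ rewrite juxtapose-left k₁ ι₁ ι₂ ℓ≤k₁ | juxtapose-left k₁ ι₁ ι₂ m≤k₁ =
      order₁ ℓ m 1≤ℓ ℓ≤k₁ 1≤m m≤k₁ fℓ<fm
    ... | right d 1≤d refl | right e 1≤e refl rewrite juxtapose-right k₁ ι₁ ι₂ 1≤d | juxtapose-right k₁ ι₁ ι₂ 1≤e =
      order₂ d e 1≤d (+-cancelˡ-≤ k₁ d k₂ ℓ≤) 1≤e (+-cancelˡ-≤ k₁ e k₂ m≤) fℓ<fm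
    ... | left ℓ≤k₁ | right e 1≤e refl rewrite juxtapose-left k₁ ι₁ ι₂ ℓ≤k₁ | juxtapose-right k₁ ι₁ ι₂ 1≤e =
      let e≤k₂ = +-cancelˡ-≤ k₁ e k₂ m≤
      in ≤-<-trans (value-≤ (bounds₁ ℓ 1≤ℓ ℓ≤k₁))
           (<-≤-trans (up ℓ e 1≤ℓ ℓ≤k₁ 1≤e e≤k₂ fℓ<fm) (value-≥ (bounds₂ e 1≤e e≤k₂)))
    ... | right d 1≤d refl | left m≤k₁ rewrite juxtapose-right k₁ ι₁ ι₂ 1≤d | juxtapose-left k₁ ι₁ ι₂ m≤k₁ =
      let d≤k₂ = +-cancelˡ-≤ k₁ d k₂ ℓ≤
      in ≤-<-trans (value-≤ (bounds₂ d 1≤d d≤k₂))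
           (<-≤-trans (down m d 1≤m m≤k₁ 1≤d d≤k₂ fℓ<fm) (value-≥ (bounds₁ m 1≤m m≤k₁)))

  occurs-split : ∀ {f n i j a b k} (occ : OccursUsingFn f n σ i j a b) → 1 ≤ k → k < n → ∀ {a₁ b₁ a₂ b₂} →
    (∀ ℓ → 1 ≤ ℓ → ℓ ≤ k → a₁ ≤ σ ! proj₁ occ ℓ × σ ! proj₁ occ ℓ ≤ b₁) →
    (∀ ℓ → 1 ≤ ℓ → ℓ ≤ n ∸ k → a₂ ≤ σ ! proj₁ occ (k + ℓ) × σ ! proj₁ occ (k + ℓ) ≤ b₂) →
    i < proj₁ occ (suc k) × proj₁ occ (suc k) ≤ j ×
    OccursUsingFn f k σ i (proj₁ occ (suc k) ∸ 1) a₁ b₁ ×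
    OccursUsingFn (λ ℓ → f (k + ℓ)) (n ∸ k) σ (proj₁ occ (suc k)) j a₂ b₂
  occurs-split {f} {n} {i} {j} {k = k} (ι , inc , bounds , order) 1≤k k<n {a₁} {b₁} {a₂} {b₂}
    prefix-values suffix-values =
    ≤-<-trans (position-≥ (bounds 1 ≤-refl 1≤n)) (increasing-< inc ≤-refl (s≤s 1≤k) k<n) ,
    position-≤ (bounds (suc k) (s≤s z≤n) k<n) ,
    (ι , (λ ℓ 1≤ℓ ℓ<k → inc ℓ 1≤ℓ (<-trans ℓ<k k<n)) , prefix-bounds ,
      λ ℓ m 1≤ℓ ℓ≤k 1≤m m≤k → order ℓ m 1≤ℓ (≤-trans ℓ≤k k≤n) 1≤m (≤-trans m≤k k≤n)) ,
    ((λ ℓ → ι (k + ℓ)) ,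
      (λ ℓ 1≤ℓ ℓ< → subst (λ t → ι (k + ℓ) < ι t) (sym (+-suc k ℓ))
                      (inc (k + ℓ) (m≤n⇒m≤o+n k 1≤ℓ) (<∸⇒+< k≤n ℓ<))) ,
      suffix-bounds ,
      λ ℓ m 1≤ℓ ℓ≤ 1≤m m≤ → order (k + ℓ) (k + m) (m≤n⇒m≤o+n k 1≤ℓ) (≤∸⇒+≤ k≤n ℓ≤) (m≤n⇒m≤o+n k 1≤m) (≤∸⇒+≤ k≤n m≤))
    where
    k≤n : k ≤ n
    k≤n = <⇒≤ k<n
    1≤n : 1 ≤ n
    1≤n = ≤-trans 1≤k k≤n
    prefix-bounds : ∀ ℓ → 1 ≤ ℓ → ℓ ≤ k → InBox σ i (ι (suc k) ∸ 1) a₁ b₁ (ι ℓ)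
    prefix-bounds ℓ 1≤ℓ ℓ≤k =
      let (p₁ , p₂ , p₃ , _) = bounds ℓ 1≤ℓ (≤-trans ℓ≤k k≤n)
      in p₁ , p₂ , p₃ , m<n⇒m≤n∸1 (increasing-< inc 1≤ℓ (s≤s ℓ≤k) k<n) , prefix-values ℓ 1≤ℓ ℓ≤k
    suffix-bounds : ∀ ℓ → 1 ≤ ℓ → ℓ ≤ n ∸ k → InBox σ (ι (suc k)) j a₂ b₂ (ι (k + ℓ))
    suffix-bounds ℓ 1≤ℓ ℓ≤ =
      let (p₁ , p₂ , _ , p₄ , _) = bounds (k + ℓ) (m≤n⇒m≤o+n k 1≤ℓ) (≤∸⇒+≤ k≤n ℓ≤)
      in p₁ , p₂ , increasing-≤ inc (s≤s z≤n) (subst (_≤ k + ℓ) (+-comm k 1) (+-monoʳ-≤ k 1≤ℓ)) (≤∸⇒+≤ k≤n ℓ≤) ,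
         p₄ , suffix-values ℓ 1≤ℓ ℓ≤

  occurs-split-⊕ : ∀ {f n i j a b k} → OccursUsingFn f n σ i j a b → 1 ≤ k → k < n → SplitsAt _<_ f n k →
    DirectParts σ f n k i j a b
  occurs-split-⊕ {n = n} {k = k} occ@(ι , _ , bounds , order) 1≤k k<n split =
    let (c , a<c , c≤b , prefix-<c , suffix-≥c) =
          threshold (λ x → σ ! ι x) (λ y → σ ! ι (k + y)) 1≤k 1≤n∸k
            (value-≥ (bounds 1 ≤-refl (≤-trans 1≤k k≤n))) (value-≤ (bounds (k + 1) (m≤n⇒m≤o+n k ≤-refl) (≤∸⇒+≤ k≤n 1≤n∸k)))
            prefix-below-suffix
        (i<h , h≤j , prefix , suffix) = occurs-split occ 1≤k k<n
          (λ ℓ 1≤ℓ ℓ≤k → value-≥ (bounds ℓ 1≤ℓ (≤-trans ℓ≤k k≤n)) , prefix-<c ℓ 1≤ℓ ℓ≤k)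
          (λ ℓ 1≤ℓ ℓ≤ → suffix-≥c ℓ 1≤ℓ ℓ≤ , value-≤ (bounds (k + ℓ) (m≤n⇒m≤o+n k 1≤ℓ) (≤∸⇒+≤ k≤n ℓ≤)))
    in record { h = ι (suc k) ; c = c ; cut = i<h , h≤j , a<c , c≤b ; prefix = prefix ; suffix = suffix }
    where
    k≤n : k ≤ n
    k≤n = <⇒≤ k<n
    1≤n∸k : 1 ≤ n ∸ k
    1≤n∸k = m<n⇒0<n∸m k<n
    prefix-below-suffix : ∀ x y → 1 ≤ x → x ≤ k → 1 ≤ y → y ≤ n ∸ k → σ ! ι x < σ ! ι (k + y)
    prefix-below-suffix x y 1≤x x≤k 1≤y y≤ =
      order x (k + y) 1≤x (≤-trans x≤k k≤n) (m≤n⇒m≤o+n k 1≤y) (≤∸⇒+≤ k≤n y≤)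
        (split x (k + y) 1≤x x≤k (m<m+n k 1≤y) (≤∸⇒+≤ k≤n y≤))

  occurs-split-⊖ : ∀ {f n i j a b k} → OccursUsingFn f n σ i j a b → 1 ≤ k → k < n → SplitsAt (flip _<_) f n k →
    SkewParts σ f n k i j a b
  occurs-split-⊖ {n = n} {k = k} occ@(ι , _ , bounds , order) 1≤k k<n split =
    let (c , a<c , c≤b , suffix-<c , prefix-≥c) =
          threshold (λ x → σ ! ι (k + x)) (λ y → σ ! ι y) 1≤n∸k 1≤k
            (value-≥ (bounds (k + 1) (m≤n⇒m≤o+n k ≤-refl) (≤∸⇒+≤ k≤n 1≤n∸k))) (value-≤ (bounds 1 ≤-refl (≤-trans 1≤k k≤n)))
            suffix-below-prefix
        (i<h , h≤j , prefix , suffix) = occurs-split occ 1≤k k<n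
          (λ ℓ 1≤ℓ ℓ≤k → prefix-≥c ℓ 1≤ℓ ℓ≤k , value-≤ (bounds ℓ 1≤ℓ (≤-trans ℓ≤k k≤n)))
          (λ ℓ 1≤ℓ ℓ≤ → value-≥ (bounds (k + ℓ) (m≤n⇒m≤o+n k 1≤ℓ) (≤∸⇒+≤ k≤n ℓ≤)) , suffix-<c ℓ 1≤ℓ ℓ≤)
    in record { h = ι (suc k) ; c = c ; cut = i<h , h≤j , a<c , c≤b ; prefix = prefix ; suffix = suffix }
    where
    k≤n : k ≤ n
    k≤n = <⇒≤ k<n
    1≤n∸k : 1 ≤ n ∸ k
    1≤n∸k = m<n⇒0<n∸m k<n
    suffix-below-prefix : ∀ x y → 1 ≤ x → x ≤ n ∸ k → 1 ≤ y → y ≤ k → σ ! ι (k + x) < σ ! ι y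
    suffix-below-prefix x y 1≤x x≤ 1≤y y≤k =
      order (k + x) y (m≤n⇒m≤o+n k 1≤x) (≤∸⇒+≤ k≤n x≤) 1≤y (≤-trans y≤k k≤n)
        (split y (k + x) 1≤y y≤k (m<m+n k 1≤x) (≤∸⇒+≤ k≤n x≤))

  occurs-shifted : ∀ {S A cA B cB i h j a b a₁ b₁ a₂ b₂} → ShiftedConcat S A cA B cB →
    OccursUsing A σ i (h ∸ 1) a₁ b₁ → OccursUsing B σ h j a₂ b₂ →
    i < h → h ≤ j → a ≤ a₁ → b₁ ≤ b → a ≤ a₂ → b₂ ≤ b →
    (∀ x y → 1 ≤ x → x ≤ length A → 1 ≤ y → y ≤ length B → A ! x + cA < B ! y + cB → b₁ < a₂) →
    (∀ x y → 1 ≤ x → x ≤ length A → 1 ≤ y → y ≤ length B → B ! y + cB < A ! x + cA → b₂ < a₁) →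
    OccursUsing S σ i j a b
  occurs-shifted {S} {A} {i = i} {h} {j} {a} {b} shifted occ-A occ-B i<h h≤j a≤a₁ b₁≤b a≤a₂ b₂≤b up down =
    subst (λ n → OccursUsingFn (S !_) n σ i j a b) (sym length-≡)
      (occurs-concat (occurs-reflect (shifted-prefix-reflects shifted) occ-A)
        (occurs-reflect (shifted-suffix-reflects shifted) occ-B)
        (m<n⇒n∸1<n i<h) (<⇒≤ i<h) (≤-trans (m∸n≤m h 1) h≤j) a≤a₁ b₁≤b a≤a₂ b₂≤b
        (λ x y 1≤x x≤ 1≤y y≤ → up x y 1≤x x≤ 1≤y y≤ ∘ subst₂ _<_ (prefix x 1≤x x≤) (suffix y 1≤y y≤))
        (λ x y 1≤x x≤ 1≤y y≤ → down x y 1≤x x≤ 1≤y y≤ ∘ subst₂ _<_ (suffix y 1≤y y≤) (prefix x 1≤x x≤)))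
    where open ShiftedConcat shifted

  occurs-⊕ : ∀ {A B i j a b h c} → IsPerm A → IsPerm B →
    OccursUsing A σ i (h ∸ 1) a (c ∸ 1) → OccursUsing B σ h j c b →
    i < h → h ≤ j → a < c → c ≤ b → OccursUsing (A ⊕ B) σ i j a b
  occurs-⊕ {A} {B} {c = c} perm-A perm-B occ-A occ-B i<h h≤j a<c c≤b =
    occurs-shifted (⊕-shifted A B) occ-A occ-B i<h h≤j ≤-refl (≤-trans (m∸n≤m c 1) c≤b) (<⇒≤ a<c) ≤-refl
      (λ _ _ _ _ _ _ _ → m<n⇒n∸1<n a<c)
      (λ x y 1≤x x≤ 1≤y y≤ B<A → ⊥-elim (<-asym B<A (⊕-values-< perm-A perm-B x y 1≤x x≤ 1≤y y≤)))

  occurs-⊖ : ∀ {A B i j a b h c} → IsPerm A → IsPerm B →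
    OccursUsing A σ i (h ∸ 1) c b → OccursUsing B σ h j a (c ∸ 1) →
    i < h → h ≤ j → a < c → c ≤ b → OccursUsing (A ⊖ B) σ i j a b
  occurs-⊖ {A} {B} {c = c} perm-A perm-B occ-A occ-B i<h h≤j a<c c≤b =
    occurs-shifted (⊖-shifted A B) occ-A occ-B i<h h≤j (<⇒≤ a<c) ≤-refl ≤-refl (≤-trans (m∸n≤m c 1) c≤b)
      (λ x y 1≤x x≤ 1≤y y≤ A<B → ⊥-elim (<-asym A<B (⊖-values-< perm-A perm-B x y 1≤x x≤ 1≤y y≤)))
      (λ _ _ _ _ _ _ _ → m<n⇒n∸1<n a<c)

  occurs-ε : ∀ {i j a b} → OccursUsing ε σ i j a b
  occurs-ε = (λ _ → 0) , (λ _ _ ()) , (λ _ 1≤ℓ ℓ≤0 → ⊥-elim (<⇒≱ 1≤ℓ ℓ≤0)) , λ _ _ 1≤ℓ ℓ≤0 → ⊥-elim (<⇒≱ 1≤ℓ ℓ≤0)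

  occurs-one : ∀ {i j a b h} → InBox σ i j a b h → OccursUsing one σ i j a b
  occurs-one {h = h} h∈box = (λ _ → h) , (λ ℓ 1≤ℓ ℓ<1 → ⊥-elim (<⇒≱ ℓ<1 1≤ℓ)) , (λ _ _ _ → h∈box) , irreflexive
    where
    irreflexive : ∀ ℓ m → 1 ≤ ℓ → ℓ ≤ 1 → 1 ≤ m → m ≤ 1 → one ! ℓ < one ! m → σ ! h < σ ! h
    irreflexive ℓ m 1≤ℓ ℓ≤1 1≤m m≤1 lt =
      ⊥-elim (<-irrefl (cong (one !_) (trans (≤-antisym ℓ≤1 1≤ℓ) (≤-antisym 1≤m m≤1))) lt)

  occurs-length : ∀ {f n i j a b} → OccursUsingFn f n σ i j a b → n ≤ length σ
  occurs-length {n = zero} _ = z≤n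
  occurs-length {n = suc n} (ι , inc , bounds , _) =
    ≤-trans (at-least (suc n) (s≤s z≤n) ≤-refl) (proj₁ (proj₂ (bounds (suc n) (s≤s z≤n) ≤-refl)))
    where
    at-least : ∀ ℓ → 1 ≤ ℓ → ℓ ≤ suc n → ℓ ≤ ι ℓ
    at-least (suc zero) _ _ = proj₁ (bounds 1 ≤-refl (s≤s z≤n))
    at-least (suc (suc ℓ)) _ ℓ< =
      ≤-trans (s≤s (at-least (suc ℓ) (s≤s z≤n) (<⇒≤ ℓ<))) (inc (suc ℓ) (s≤s z≤n) ℓ<)

  occurs-witness : ∀ {f n i j a b} → 1 ≤ n → OccursUsingFn f n σ i j a b → ∃ (InBox σ i j a b)
  occurs-witness 1≤n (ι , _ , bounds , _) = ι 1 , bounds 1 ≤-refl 1≤n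

  occurs-wide : ∀ {f n i j a b} → 2 ≤ n → Distinct f n → OccursUsingFn f n σ i j a b → i < j × a < b
  occurs-wide {f} {n} {i} {j} {a} {b} 2≤n distinct (ι , inc , bounds , order) =
    ≤-<-trans (position-≥ (bounds 1 ≤-refl 1≤n)) (<-≤-trans (inc 1 ≤-refl 2≤n) (position-≤ (bounds 2 (s≤s z≤n) 2≤n))) ,
    values-differ (<-cmp (f 1) (f 2))
    where
    1≤n : 1 ≤ n
    1≤n = ≤-trans (s≤s z≤n) 2≤n
    v₁ : InBox σ i j a b (ι 1)
    v₁ = bounds 1 ≤-refl 1≤n
    v₂ : InBox σ i j a b (ι 2)
    v₂ = bounds 2 (s≤s z≤n) 2≤n
    values-differ : Tri (f 1 < f 2) (f 1 ≡ f 2) (f 2 < f 1) → a < b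
    values-differ (tri< f₁<f₂ _ _) =
      ≤-<-trans (value-≥ v₁) (<-≤-trans (order 1 2 ≤-refl 1≤n (s≤s z≤n) 2≤n f₁<f₂) (value-≤ v₂))
    values-differ (tri> _ _ f₂<f₁) =
      ≤-<-trans (value-≥ v₂) (<-≤-trans (order 2 1 (s≤s z≤n) 2≤n ≤-refl 1≤n f₂<f₁) (value-≤ v₁))
    values-differ (tri≈ _ f₁≡f₂ _) with distinct 1 2 ≤-refl 1≤n (s≤s z≤n) 2≤n f₁≡f₂
    ... | ()

-- Separable permutations

≤! : ∀ {m n} {m≤n : True (m ≤? n)} → m ≤ n
≤! {m≤n = m≤n} = toWitness m≤n

pattern2413 pattern3142 : List ℕ
pattern2413 = 2 ∷ 4 ∷ 1 ∷ 3 ∷ []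
pattern3142 = 3 ∷ 1 ∷ 4 ∷ 2 ∷ []

quad : ℕ → ℕ → ℕ → ℕ → ℕ → ℕ
quad a b c d 1 = a
quad a b c d 2 = b
quad a b c d 3 = c
quad a b c d _ = d

quad-increasing : ∀ {a b c d} → a < b → b < c → c < d → Increasing (quad a b c d) 4
quad-increasing a<b b<c c<d 1 _ _ = a<b
quad-increasing a<b b<c c<d 2 _ _ = b<c
quad-increasing a<b b<c c<d 3 _ _ = c<d
quad-increasing a<b b<c c<d (suc (suc (suc (suc _)))) _ (s≤s (s≤s (s≤s (s≤s ()))))

-- g lists the values of τ at ι in the order of their ranks in ρ.
occurrence-from-ranks : ∀ ρ τ (ι g : ℕ → ℕ) → IsPerm τ →
  Increasing ι (length ρ) → 1 ≤ ι 1 → ι (length ρ) ≤ length τ → Increasing g (length ρ) →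
  (∀ ℓ → 1 ≤ ℓ → ℓ ≤ length ρ → 1 ≤ ρ ! ℓ × ρ ! ℓ ≤ length ρ × τ ! ι ℓ ≡ g (ρ ! ℓ)) →
  IsPatternOf ρ τ
occurrence-from-ranks ρ τ ι g perm inc 1≤ι₁ ι≤τ inc-g ranks = ι , inc , bounds , order
  where
  bounds : ∀ ℓ → 1 ≤ ℓ → ℓ ≤ length ρ → 1 ≤ ι ℓ × ι ℓ ≤ length τ × 1 ≤ ι ℓ × ι ℓ ≤ length τ ×
    1 ≤ τ ! ι ℓ × τ ! ι ℓ ≤ length τ
  bounds ℓ 1≤ℓ ℓ≤ρ = 1≤ιℓ , ιℓ≤τ , 1≤ιℓ , ιℓ≤τ , perm-bounds perm 1≤ιℓ ιℓ≤τ
    where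
    1≤ιℓ : 1 ≤ ι ℓ
    1≤ιℓ = ≤-trans 1≤ι₁ (increasing-≤ inc ≤-refl 1≤ℓ ℓ≤ρ)
    ιℓ≤τ : ι ℓ ≤ length τ
    ιℓ≤τ = ≤-trans (increasing-≤ inc 1≤ℓ ℓ≤ρ ≤-refl) ι≤τ
  order : ∀ ℓ m → 1 ≤ ℓ → ℓ ≤ length ρ → 1 ≤ m → m ≤ length ρ → ρ ! ℓ < ρ ! m → τ ! ι ℓ < τ ! ι m
  order ℓ m 1≤ℓ ℓ≤ρ 1≤m m≤ρ ρℓ<ρm with ranks ℓ 1≤ℓ ℓ≤ρ | ranks m 1≤m m≤ρ
  ... | 1≤ρℓ , _ , eqℓ | _ , ρm≤ρ , eqm = subst₂ _<_ (sym eqℓ) (sym eqm) (increasing-< inc-g 1≤ρℓ ρℓ<ρm ρm≤ρ)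

Avoids⇒Avoids3142 : ∀ {τ} → IsPerm τ → Avoids τ pattern3142 → Avoids3142 _<_ (τ !_) (length τ)
Avoids⇒Avoids3142 {τ} perm avoid i₁ i₂ i₃ i₄ 1≤i₁ i₁<i₂ i₂<i₃ i₃<i₄ i₄≤τ r₁ r₂ r₃ =
  avoid (occurrence-from-ranks pattern3142 τ (quad i₁ i₂ i₃ i₄) g perm
    (quad-increasing i₁<i₂ i₂<i₃ i₃<i₄) 1≤i₁ i₄≤τ (quad-increasing r₁ r₂ r₃) ranks)
  where
  g : ℕ → ℕ
  g = quad (τ ! i₂) (τ ! i₄) (τ ! i₁) (τ ! i₃)
  ranks : ∀ ℓ → 1 ≤ ℓ → ℓ ≤ 4 →
    1 ≤ pattern3142 ! ℓ × pattern3142 ! ℓ ≤ 4 × τ ! quad i₁ i₂ i₃ i₄ ℓ ≡ g (pattern3142 ! ℓ)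
  ranks 1 _ _ = ≤! , ≤! , refl
  ranks 2 _ _ = ≤! , ≤! , refl
  ranks 3 _ _ = ≤! , ≤! , refl
  ranks 4 _ _ = ≤! , ≤! , refl
  ranks (suc (suc (suc (suc (suc _))))) _ (s≤s (s≤s (s≤s (s≤s ()))))

Avoids⇒Avoids2413 : ∀ {τ} → IsPerm τ → Avoids τ pattern2413 → Avoids2413 (τ !_) (length τ)
Avoids⇒Avoids2413 {τ} perm avoid i₁ i₂ i₃ i₄ 1≤i₁ i₁<i₂ i₂<i₃ i₃<i₄ i₄≤τ r₁ r₂ r₃ =
  avoid (occurrence-from-ranks pattern2413 τ (quad i₁ i₂ i₃ i₄) g perm
    (quad-increasing i₁<i₂ i₂<i₃ i₃<i₄) 1≤i₁ i₄≤τ (quad-increasing r₃ r₂ r₁) ranks)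
  where
  g : ℕ → ℕ
  g = quad (τ ! i₃) (τ ! i₁) (τ ! i₄) (τ ! i₂)
  ranks : ∀ ℓ → 1 ≤ ℓ → ℓ ≤ 4 →
    1 ≤ pattern2413 ! ℓ × pattern2413 ! ℓ ≤ 4 × τ ! quad i₁ i₂ i₃ i₄ ℓ ≡ g (pattern2413 ! ℓ)
  ranks 1 _ _ = ≤! , ≤! , refl
  ranks 2 _ _ = ≤! , ≤! , refl
  ranks 3 _ _ = ≤! , ≤! , refl
  ranks 4 _ _ = ≤! , ≤! , refl
  ranks (suc (suc (suc (suc (suc _))))) _ (s≤s (s≤s (s≤s (s≤s ()))))

Avoids3142⇒Avoids : ∀ {τ} → Avoids3142 _<_ (τ !_) (length τ) → Avoids τ pattern3142
Avoids3142⇒Avoids avoid (ι , inc , bounds , order) =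
  avoid (ι 1) (ι 2) (ι 3) (ι 4) (proj₁ (bounds 1 ≤! ≤!)) (inc 1 ≤! ≤!) (inc 2 ≤! ≤!) (inc 3 ≤! ≤!)
    (proj₁ (proj₂ (bounds 4 ≤! ≤!)))
    (order 2 4 ≤! ≤! ≤! ≤! ≤!) (order 4 1 ≤! ≤! ≤! ≤! ≤!) (order 1 3 ≤! ≤! ≤! ≤! ≤!)

Avoids2413⇒Avoids : ∀ {τ} → Avoids2413 (τ !_) (length τ) → Avoids τ pattern2413
Avoids2413⇒Avoids avoid (ι , inc , bounds , order) =
  avoid (ι 1) (ι 2) (ι 3) (ι 4) (proj₁ (bounds 1 ≤! ≤!)) (inc 1 ≤! ≤!) (inc 2 ≤! ≤!) (inc 3 ≤! ≤!)
    (proj₁ (proj₂ (bounds 4 ≤! ≤!)))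
    (order 4 2 ≤! ≤! ≤! ≤! ≤!) (order 1 4 ≤! ≤! ≤! ≤! ≤!) (order 3 1 ≤! ≤! ≤! ≤! ≤!)

separable⇒separableFn : ∀ {τ} → Separable τ → SeparableFn (τ !_) (length τ)
separable⇒separableFn (perm , avoid2413 , avoid3142) =
  perm-distinct perm , Avoids⇒Avoids3142 perm avoid3142 , Avoids⇒Avoids2413 perm avoid2413

separable-shifted : ∀ {S A cA B cB} → ShiftedConcat S A cA B cB → IsPerm S → Separable A → Separable B →
  SplitsAt _<_ (S !_) (length S) (length A) ⊎ SplitsAt (flip _<_) (S !_) (length S) (length A) →
  Separable S
separable-shifted {S} {A} {cA} {B} {cB} shifted perm-S sep-A sep-B split =
  perm-S ,
  Avoids2413⇒Avoids {S} (avoid-S {flip _<_} <-asym (swap split) (reflects-flip prefix-reflects) (reflects-flip suffix-reflects)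
    (proj₂ (proj₂ fn-A)) (proj₂ (proj₂ fn-B))) ,
  Avoids3142⇒Avoids {S} (avoid-S {_<_} <-asym split prefix-reflects suffix-reflects (proj₁ (proj₂ fn-A)) (proj₁ (proj₂ fn-B)))
  where
  open ShiftedConcat shifted using (length-≡)
  fn-A : SeparableFn (A !_) (length A)
  fn-A = separable⇒separableFn {A} sep-A
  fn-B : SeparableFn (B !_) (length B)
  fn-B = separable⇒separableFn {B} sep-B
  prefix-reflects : Reflects _<_ (S !_) (A !_) (length A)
  prefix-reflects = shifted-prefix-reflects shifted
  suffix-reflects : Reflects _<_ (λ y → S ! (length A + y)) (B !_) (length B)
  suffix-reflects = shifted-suffix-reflects shifted
  A≤S : length A ≤ length S
  A≤S = subst (length A ≤_) (sym length-≡) (m≤m+n (length A) (length B))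
  S∸A≡B : length S ∸ length A ≡ length B
  S∸A≡B = trans (cong (_∸ length A) length-≡) (m+n∸m≡n (length A) (length B))
  avoid-S : ∀ {_≺_} → Asymmetric _≺_ →
    SplitsAt _≺_ (S !_) (length S) (length A) ⊎ SplitsAt (flip _≺_) (S !_) (length S) (length A) →
    Reflects _≺_ (S !_) (A !_) (length A) → Reflects _≺_ (λ y → S ! (length A + y)) (B !_) (length B) →
    Avoids3142 _≺_ (A !_) (length A) → Avoids3142 _≺_ (B !_) (length B) → Avoids3142 _≺_ (S !_) (length S)
  avoid-S {_≺_} asym split reflects-A reflects-B avoid-A avoid-B =
    Avoids3142-sum {_≺_} asym A≤S split (Avoids3142-reflect {_≺_} reflects-A avoid-A)
      (subst (Avoids3142 _≺_ (λ y → S ! (length A + y))) (sym S∸A≡B) (Avoids3142-reflect {_≺_} reflects-B avoid-B))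

separable-⊕ : ∀ {A B} → Separable A → Separable B → Separable (A ⊕ B)
separable-⊕ {A} {B} sep-A@(perm-A , _) sep-B@(perm-B , _) =
  separable-shifted (⊕-shifted A B) (perm-⊕ perm-A perm-B) sep-A sep-B (inj₁ (⊕-splitsAt perm-A perm-B))

separable-⊖ : ∀ {A B} → Separable A → Separable B → Separable (A ⊖ B)
separable-⊖ {A} {B} sep-A@(perm-A , _) sep-B@(perm-B , _) =
  separable-shifted (⊖-shifted A B) (perm-⊖ perm-A perm-B) sep-A sep-B (inj₂ (⊖-splitsAt perm-A perm-B))

Avoids-shorter : ∀ {τ ρ} → length τ < length ρ → Avoids τ ρ
Avoids-shorter {τ} τ<ρ occ = <⇒≱ τ<ρ (occurs-length τ occ)

separable-ε : Separable ε
separable-ε = ↭-refl , Avoids-shorter {ε} ≤! , Avoids-shorter {ε} ≤!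

separable-one : Separable one
separable-one = ↭-refl , Avoids-shorter {one} ≤! , Avoids-shorter {one} ≤!

-- The dynamic program

Interval : ℕ → ℕ → ℕ → Set
Interval lo hi n = 1 ≤ lo × lo ≤ hi × hi ≤ n

interval-below : ∀ {lo hi n m} → Interval lo hi n → lo < m → m ≤ hi → Interval lo (m ∸ 1) n
interval-below (1≤lo , _ , hi≤n) lo<m m≤hi = 1≤lo , m<n⇒m≤n∸1 lo<m , ≤-trans (m∸n≤m _ 1) (≤-trans m≤hi hi≤n)

interval-above : ∀ {lo hi n m} → Interval lo hi n → lo < m → m ≤ hi → Interval m hi n
interval-above (1≤lo , _ , hi≤n) lo<m m≤hi = ≤-trans 1≤lo (<⇒≤ lo<m) , m≤hi , hi≤n

module DynamicProgram {K : ℕ} (q₀ : Fin K) (σ : Fin K → List ℕ) (M : Array K) (dp : IsDPArray σ M) where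

  unfilled-entry : ∀ i j a b → ¬ Filled σ i j a b → M i j a b ≡ ε
  unfilled-entry = proj₁ dp

  degenerate-entry : ∀ i j a b → Filled σ i j a b → Degenerate σ i j a b →
    (CondT σ i j a b → M i j a b ≡ one) × (¬ CondT σ i j a b → M i j a b ≡ ε)
  degenerate-entry = proj₁ (proj₂ dp)

  split-entry : ∀ i j a b → Filled σ i j a b → ¬ Degenerate σ i j a b →
    Candidate σ M i j a b (M i j a b) × (∀ τ → Candidate σ M i j a b τ → length τ ≤ length (M i j a b))
  split-entry = proj₂ (proj₂ dp)

  CondT? : ∀ i j a b → Dec (CondT σ i j a b)
  CondT? i j a b = all? λ q → ∃-between? (λ h → (a q ≤? σ q ! h) ×-dec (σ q ! h ≤? b q)) (i q) (j q)

  Degenerate? : ∀ i j a b → Dec (Degenerate σ i j a b)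
  Degenerate? i j a b = any? λ q → (i q ≟ j q) ⊎-dec (a q ≟ b q)

  positions : ∀ {i j a b} → Filled σ i j a b → ∀ q → Interval (i q) (j q) (len σ q)
  positions filled q = let (1≤i , i≤j , j≤n , _) = filled q in 1≤i , i≤j , j≤n

  values : ∀ {i j a b} → Filled σ i j a b → ∀ q → Interval (a q) (b q) (len σ q)
  values filled = proj₂ ∘ proj₂ ∘ proj₂ ∘ filled

  filled : ∀ {i j a b} → (∀ q → Interval (i q) (j q) (len σ q)) → (∀ q → Interval (a q) (b q) (len σ q)) →
    Filled σ i j a b
  filled pos val q = let (1≤i , i≤j , j≤n) = pos q in 1≤i , i≤j , j≤n , val q

  module _ {i j a b h c} (fl : Filled σ i j a b) (sp : Split σ i j a b h c) where

    private
      lower-positions : ∀ q → Interval (i q) (h q ∸ 1) (len σ q)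
      lower-positions q = let (i<h , h≤j , _) = sp q in interval-below (positions fl q) i<h h≤j

      upper-positions : ∀ q → Interval (h q) (j q) (len σ q)
      upper-positions q = let (i<h , h≤j , _) = sp q in interval-above (positions fl q) i<h h≤j

      lower-values : ∀ q → Interval (a q) (c q ∸ 1) (len σ q)
      lower-values q = let (_ , _ , a<c , c≤b) = sp q in interval-below (values fl q) a<c c≤b

      upper-values : ∀ q → Interval (c q) (b q) (len σ q)
      upper-values q = let (_ , _ , a<c , c≤b) = sp q in interval-above (values fl q) a<c c≤b

    filled-⊕-left : Filled σ i (λ q → h q ∸ 1) a (λ q → c q ∸ 1)
    filled-⊕-left = filled lower-positions lower-values

    filled-⊕-right : Filled σ h j c b
    filled-⊕-right = filled upper-positions upper-values

    filled-⊖-left : Filled σ i (λ q → h q ∸ 1) c b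
    filled-⊖-left = filled lower-positions upper-values

    filled-⊖-right : Filled σ h j a (λ q → c q ∸ 1)
    filled-⊖-right = filled upper-positions lower-values

  inBox-of-condT : ∀ {i j a b} → Filled σ i j a b → CondT σ i j a b → ∀ q → ∃ (InBox (σ q) (i q) (j q) (a q) (b q))
  inBox-of-condT fl t q =
    let (h , i≤h , h≤j , a≤σh , σh≤b) = t q
        (1≤i , _ , j≤n) = positions fl q
    in h , ≤-trans 1≤i i≤h , ≤-trans h≤j j≤n , i≤h , h≤j , a≤σh , σh≤b

  condT-of-inBox : ∀ {i j a b} → (∀ q → ∃ (InBox (σ q) (i q) (j q) (a q) (b q))) → CondT σ i j a b
  condT-of-inBox inBox q = let (h , _ , _ , in-box) = inBox q in h , in-box

  -- Both parts of every split have fewer positions in σ q₀ than the whole box; this is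
  -- where K ≥ 1 is used.
  width : (i j : Fin K → ℕ) → ℕ
  width i j = j q₀ ∸ i q₀

  Sound : (i j a b : Fin K → ℕ) → List ℕ → Set
  Sound i j a b τ = Separable τ × (∀ q → OccursUsing τ (σ q) (i q) (j q) (a q) (b q))

  sound-ε : ∀ {i j a b} → Sound i j a b ε
  sound-ε = separable-ε , λ q → occurs-ε (σ q)

  sound-one : ∀ {i j a b} → Filled σ i j a b → CondT σ i j a b → Sound i j a b one
  sound-one fl t = separable-one , λ q → occurs-one (σ q) (proj₂ (inBox-of-condT fl t q))

  sound : ∀ i j a b → Acc _<_ (width i j) → Filled σ i j a b → Sound i j a b (M i j a b)
  sound i j a b _ fl with Degenerate? i j a b | CondT? i j a b
  ... | yes deg | yes t = subst (Sound i j a b) (sym (proj₁ (degenerate-entry i j a b fl deg) t)) (sound-one fl t)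
  ... | yes deg | no ¬t = subst (Sound i j a b) (sym (proj₂ (degenerate-entry i j a b fl deg) ¬t)) sound-ε
  sound i j a b (acc rec) fl | no ¬deg | _ = sound-candidate (proj₁ (split-entry i j a b fl ¬deg))
    where
    sound-candidate : ∀ {τ} → Candidate σ M i j a b τ → Sound i j a b τ
    sound-candidate (inj₁ (h , c , sp , refl)) =
      let (i<h , h≤j , _) = sp q₀
          (sep-A , occ-A) = sound i _ a _ (rec (m<n≤o⇒n∸1∸m<o∸m i<h h≤j)) (filled-⊕-left fl sp)
          (sep-B , occ-B) = sound h j c b (rec (∸-monoʳ-< i<h h≤j)) (filled-⊕-right fl sp)
      in separable-⊕ sep-A sep-B , λ q → let (i<h , h≤j , a<c , c≤b) = sp q in
           occurs-⊕ (σ q) (proj₁ sep-A) (proj₁ sep-B) (occ-A q) (occ-B q) i<h h≤j a<c c≤b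
    sound-candidate (inj₂ (inj₁ (h , c , sp , refl))) =
      let (i<h , h≤j , _) = sp q₀
          (sep-A , occ-A) = sound i _ c b (rec (m<n≤o⇒n∸1∸m<o∸m i<h h≤j)) (filled-⊖-left fl sp)
          (sep-B , occ-B) = sound h j a _ (rec (∸-monoʳ-< i<h h≤j)) (filled-⊖-right fl sp)
      in separable-⊖ sep-A sep-B , λ q → let (i<h , h≤j , a<c , c≤b) = sp q in
           occurs-⊖ (σ q) (proj₁ sep-A) (proj₁ sep-B) (occ-A q) (occ-B q) i<h h≤j a<c c≤b
    sound-candidate (inj₂ (inj₂ (inj₁ (t , refl)))) = sound-one fl t
    sound-candidate (inj₂ (inj₂ (inj₂ (_ , refl)))) = sound-ε

  entry-nonempty : ∀ i j a b → Filled σ i j a b → CondT σ i j a b → 1 ≤ length (M i j a b)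
  entry-nonempty i j a b fl t with Degenerate? i j a b
  ... | yes deg = ≤-reflexive (sym (cong length (proj₁ (degenerate-entry i j a b fl deg) t)))
  ... | no ¬deg = proj₂ (split-entry i j a b fl ¬deg) one (inj₂ (inj₂ (inj₁ (t , refl))))

  OccursInAll : (ℕ → ℕ) → ℕ → (i j a b : Fin K → ℕ) → Set
  OccursInAll f n i j a b = ∀ q → OccursUsingFn f n (σ q) (i q) (j q) (a q) (b q)

  Maximal : (i j a b : Fin K → ℕ) → Set
  Maximal i j a b = ∀ {f} n → SeparableFn f n → OccursInAll f n i j a b → n ≤ length (M i j a b)

  MaximalBelow : (i j : Fin K → ℕ) → Set
  MaximalBelow i j = ∀ i′ j′ a′ b′ → width i′ j′ < width i j → Filled σ i′ j′ a′ b′ → Maximal i′ j′ a′ b′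

  maximal-⊕ : ∀ {i j a b f n k} → MaximalBelow i j → Filled σ i j a b → ¬ Degenerate σ i j a b →
    SeparableFn f n → OccursInAll f n i j a b → 1 ≤ k → k < n → SplitsAt _<_ f n k → n ≤ length (M i j a b)
  maximal-⊕ {i} {j} {a} {b} {f} {n} {k} below fl ¬deg sep occ 1≤k k<n split =
    split-≤ k≤n
      (below i _ a _ (m<n≤o⇒n∸1∸m<o∸m i<h h≤j) (filled-⊕-left fl sp) k (SeparableFn-prefix k≤n sep) prefix)
      (below h j c b (∸-monoʳ-< i<h h≤j) (filled-⊕-right fl sp) (n ∸ k) (SeparableFn-suffix k≤n sep) suffix)
      (≤-trans (≤-reflexive (sym (length-⊕ M₁ M₂))) (proj₂ (split-entry i j a b fl ¬deg) (M₁ ⊕ M₂) (inj₁ (h , c , sp , refl))))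
    where
    k≤n : k ≤ n
    k≤n = <⇒≤ k<n
    parts : ∀ q → DirectParts (σ q) f n k (i q) (j q) (a q) (b q)
    parts q = occurs-split-⊕ (σ q) (occ q) 1≤k k<n split
    h c : Fin K → ℕ
    h = DirectParts.h ∘ parts
    c = DirectParts.c ∘ parts
    sp : Split σ i j a b h c
    sp = DirectParts.cut ∘ parts
    prefix : OccursInAll f k i (λ q → h q ∸ 1) a (λ q → c q ∸ 1)
    prefix = DirectParts.prefix ∘ parts
    suffix : OccursInAll (λ ℓ → f (k + ℓ)) (n ∸ k) h j c b
    suffix = DirectParts.suffix ∘ parts
    i<h : i q₀ < h q₀
    i<h = proj₁ (sp q₀)
    h≤j : h q₀ ≤ j q₀
    h≤j = proj₁ (proj₂ (sp q₀))
    M₁ M₂ : List ℕ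
    M₁ = M i (λ q → h q ∸ 1) a (λ q → c q ∸ 1)
    M₂ = M h j c b

  maximal-⊖ : ∀ {i j a b f n k} → MaximalBelow i j → Filled σ i j a b → ¬ Degenerate σ i j a b →
    SeparableFn f n → OccursInAll f n i j a b → 1 ≤ k → k < n → SplitsAt (flip _<_) f n k → n ≤ length (M i j a b)
  maximal-⊖ {i} {j} {a} {b} {f} {n} {k} below fl ¬deg sep occ 1≤k k<n split =
    split-≤ k≤n
      (below i _ c b (m<n≤o⇒n∸1∸m<o∸m i<h h≤j) (filled-⊖-left fl sp) k (SeparableFn-prefix k≤n sep) prefix)
      (below h j a _ (∸-monoʳ-< i<h h≤j) (filled-⊖-right fl sp) (n ∸ k) (SeparableFn-suffix k≤n sep) suffix)
      (≤-trans (≤-reflexive (sym (length-⊖ M₁ M₂))) (proj₂ (split-entry i j a b fl ¬deg) (M₁ ⊖ M₂) (inj₂ (inj₁ (h , c , sp , refl)))))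
    where
    k≤n : k ≤ n
    k≤n = <⇒≤ k<n
    parts : ∀ q → SkewParts (σ q) f n k (i q) (j q) (a q) (b q)
    parts q = occurs-split-⊖ (σ q) (occ q) 1≤k k<n split
    h c : Fin K → ℕ
    h = SkewParts.h ∘ parts
    c = SkewParts.c ∘ parts
    sp : Split σ i j a b h c
    sp = SkewParts.cut ∘ parts
    prefix : OccursInAll f k i (λ q → h q ∸ 1) c b
    prefix = SkewParts.prefix ∘ parts
    suffix : OccursInAll (λ ℓ → f (k + ℓ)) (n ∸ k) h j a (λ q → c q ∸ 1)
    suffix = SkewParts.suffix ∘ parts
    i<h : i q₀ < h q₀
    i<h = proj₁ (sp q₀)
    h≤j : h q₀ ≤ j q₀
    h≤j = proj₁ (proj₂ (sp q₀))
    M₁ M₂ : List ℕ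
    M₁ = M i (λ q → h q ∸ 1) c b
    M₂ = M h j a (λ q → c q ∸ 1)

  maximal : ∀ i j a b → Acc _<_ (width i j) → Filled σ i j a b → Maximal i j a b
  maximal i j a b _ _ zero _ _ = z≤n
  maximal i j a b _ fl (suc zero) _ occ =
    entry-nonempty i j a b fl (condT-of-inBox λ q → occurs-witness (σ q) ≤-refl (occ q))
  maximal i j a b (acc rec) fl n@(suc (suc _)) sep@(distinct , avoid3142 , avoid2413) occ
    with Degenerate? i j a b
  ... | yes (q , inj₁ i≡j) = ⊥-elim (<-irrefl i≡j (proj₁ (occurs-wide (σ q) (s≤s (s≤s z≤n)) distinct (occ q))))
  ... | yes (q , inj₂ a≡b) = ⊥-elim (<-irrefl a≡b (proj₂ (occurs-wide (σ q) (s≤s (s≤s z≤n)) distinct (occ q))))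
  ... | no ¬deg with sumDecomposable <-isStrictTotalOrder n (s≤s (s≤s z≤n)) distinct avoid3142 avoid2413
  ...   | k , 1≤k , k<n , inj₁ split =
    maximal-⊕ (λ i′ j′ a′ b′ narrower → maximal i′ j′ a′ b′ (rec narrower)) fl ¬deg sep occ 1≤k k<n split
  ...   | k , 1≤k , k<n , inj₂ split =
    maximal-⊖ (λ i′ j′ a′ b′ narrower → maximal i′ j′ a′ b′ (rec narrower)) fl ¬deg sep occ 1≤k k<n split

  longest-in-boxes : ∀ i j a b → Filled σ i j a b → LongestSepInBoxes σ i j a b (M i j a b)
  longest-in-boxes i j a b fl =
    let (sep , occ) = sound i j a b (<-wellFounded _) fl
    in sep , occ , λ τ sep-τ occ-τ →
         maximal i j a b (<-wellFounded _) fl (length τ) (separable⇒separableFn {τ} sep-τ) occ-τ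

  ones lengths : Fin K → ℕ
  ones _ = 1
  lengths q = length (σ q)

  longest-common-pattern : LongestSepCommonPattern σ (M ones lengths ones lengths)
  longest-common-pattern with all? (λ q → 1 ≤? lengths q)
  ... | yes nonempty =
    longest-in-boxes ones lengths ones lengths λ q → ≤-refl , nonempty q , ≤-refl , ≤-refl , nonempty q , ≤-refl
  ... | no ¬nonempty =
    subst (LongestSepCommonPattern σ) (sym (unfilled-entry ones lengths ones lengths (¬nonempty ∘ nonempty)))
      (separable-ε , (λ q → occurs-ε (σ q)) , λ τ _ occ-τ → none-longer τ occ-τ)
    where
    nonempty : Filled σ ones lengths ones lengths → ∀ q → 1 ≤ lengths q
    nonempty fl q = proj₁ (proj₂ (positions fl q))
    none-longer : ∀ τ → (∀ q → IsPatternOf τ (σ q)) → length τ ≤ 0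
    none-longer [] _ = z≤n
    none-longer (_ ∷ _) occ-τ = ⊥-elim (¬nonempty λ q → ≤-trans (s≤s z≤n) (occurs-length (σ q) (occ-τ q)))

proposition1 : (K : ℕ) → 1 ≤ K → (σ : Fin K → List ℕ) → (∀ q → IsPerm (σ q)) →
    (M : Array K) → IsDPArray σ M →
    LongestSepCommonPattern σ
      (M (λ _ → 1) (λ q → length (σ q)) (λ _ → 1) (λ q → length (σ q)))
    × (∀ i j a b → Filled σ i j a b → LongestSepInBoxes σ i j a b (M i j a b))
proposition1 (suc K) _ σ _ M dp = longest-common-pattern , longest-in-boxes
  where open DynamicProgram Fin.zero σ M dp
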